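{- Let $\Sigma$ be a well-formed LF signature and $\Gamma$ a context such that $\vdash\Gamma\ \mathrm{ctx}$ is derivable. Then $\Gamma\vdash P\Rightarrow K'$ has a derivation if and only if there is an $a{:}\Pi y_1{:}A_1.\ldots\Pi y_n{:}A_n.K\in\Sigma$ such that (1) $P$ is of the form $a\,M_1\ldots M_n$; (2) there is a sequence of types $A_1',\ldots,A_n'$ such that for $1\le i\le n$ there are derivations of $[\{\langle y_1,M_1,A_1^-\rangle,\ldots,\langle y_{i-1},M_{i-1},A_{i-1}^-\rangle\}]A_i=A_i'$ and of $\Gamma\vdash M_i\Leftarrow A_i'$; and (3) $[\{\langle y_1,M_1,A_1^-\rangle,\ldots,\langle y_n,M_n,A_n^-\rangle\}]K=K'$ and $\Gamma\vdash K'\ \mathrm{kind}$ have derivations.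
   Context: Canonical LF syntax: kinds $K::=\mathrm{Type}\mid\Pi x{:}A.K$; types $A::=P\mid\Pi x{:}A.B$; atomic types $P::=a\mid P\,M$; canonical terms $M::=R\mid\lambda x.M$; atomic terms $R::=c\mid x\mid R\,M$; signatures $\Sigma::=\cdot\mid\Sigma,c{:}A\mid\Sigma,a{:}K$; contexts $\Gamma::=\cdot\mid\Gamma,x{:}A$. Arity types from $o$ and $\rightarrow$; erasure $P^-=o$, $(\Pi x{:}A_1.A_2)^-=A_1^-\rightarrow A_2^-$. A substitution is a finite set of triples $\langle x,M,\alpha\rangle$ (distinct variables, canonical terms, arity types). Hereditary substitution $[\theta]E=E'$ is the least relation closed under: $[\theta]R=R'$ if $[\theta]_rR=R'$; $[\theta]R=M'$ if $[\theta]_rR=M':\alpha'$; $[\theta](\lambda x.M)=\lambda x.M'$ if $x$ is not in $\mathrm{dom}(\theta)$ nor free in its range terms and $[\theta]M=M'$; $[\theta]_rx=M:\alpha$ if $\langle x,M,\alpha\rangle\in\theta$; $[\theta]_r(R\,M)=M''':\alpha''$ if $[\theta]_rR=\lambda x.M':\alpha'\rightarrow\alpha''$, $[\theta]M=M''$, $[\{\langle x,M'',\alpha'\rangle\}]M'=M'''$; $[\theta]_rc=c$; $[\theta]_rx=x$ if $x\notin\mathrm{dom}(\theta)$; $[\theta]_r(R\,M)=R'\,M'$ if $[\theta]_rR=R'$ and $[\theta]M=M'$; for types and kinds, substitution distributes to components ($[\theta]a=a$, $[\theta]\mathrm{Type}=\mathrm{Type}$, binders fresh for $\theta$). LF judgements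 (fixed $\Sigma$; bound variables fresh for $\Gamma$): $\vdash\cdot\ \mathrm{ctx}$; $\vdash\Gamma,x{:}A\ \mathrm{ctx}$ if $\vdash\Gamma\ \mathrm{ctx}$, $\Gamma\vdash A\ \mathrm{type}$, $x$ not in $\Gamma$; $\Gamma\vdash\mathrm{Type}\ \mathrm{kind}$; $\Gamma\vdash\Pi x{:}A.K\ \mathrm{kind}$ if $\Gamma\vdash A\ \mathrm{type}$ and $\Gamma,x{:}A\vdash K\ \mathrm{kind}$; $\Gamma\vdash P\ \mathrm{type}$ if $\Gamma\vdash P\Rightarrow\mathrm{Type}$; $\Gamma\vdash\Pi x{:}A_1.A_2\ \mathrm{type}$ if $\Gamma\vdash A_1\ \mathrm{type}$ and $\Gamma,x{:}A_1\vdash A_2\ \mathrm{type}$; $\Gamma\vdash a\Rightarrow K$ if $a{:}K\in\Sigma$; $\Gamma\vdash P\,M\Rightarrow K$ if $\Gamma\vdash P\Rightarrow\Pi x{:}A.K_1$, $\Gamma\vdash M\Leftarrow A$ and $[\{\langle x,M,A^-\rangle\}]K_1=K$; $\Gamma\vdash R\Leftarrow P$ if $\Gamma\vdash R\Rightarrow P$; $\Gamma\vdash\lambda x.M\Leftarrow\Pi x{:}A_1.A_2$ if $\Gamma,x{:}A_1\vdash M\Leftarrow A_2$; $\Gamma\vdash x\Rightarrow A$ if $x{:}A\in\Gamma$; $\Gamma\vdash c\Rightarrow A$ if $c{:}A\in\Sigma$; $\Gamma\vdash R\,M\Rightarrow A$ if $\Gamma\vdash R\Rightarrow\Pi x{:}A_1.A_2$,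 $\Gamma\vdash M\Leftarrow A_1$ and $[\{\langle x,M,A_1^-\rangle\}]A_2=A$. $\Sigma$ is well-formed if its constants are distinct and each declaration is well-formed in the empty context relative to the preceding declarations. -}

module Defs where

-- Canonical LF (as in the paper), in de Bruijn representation so that
-- syntax is taken up to alpha-equivalence.

open import Data.Nat using (ℕ; zero; suc; _∸_)
open import Data.List using (List; []; _∷_; reverse; take)
open import Data.List.Membership.Propositional using (_∈_)
open import Data.Vec using (Vec; toList; zip; map)
open import Data.Product using (_×_; _,_)
open import Relation.Nullary using (¬_)
open import Relation.Binary.PropositionalEquality using (_≡_)

Name : Set
Name = ℕ

-- Syntax.  Variables are de Bruijn indices (ℕ); index 0 = innermost binder.

mutual
  data Tm : Set where
    at  : ATm → Tm
    lam : Tm → Tm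

  data ATm : Set where
    con : Name → ATm
    var : ℕ → ATm
    app : ATm → Tm → ATm

mutual
  data ATy : Set where
    fam  : Name → ATy
    appT : ATy → Tm → ATy

  data Ty : Set where
    atom : ATy → Ty
    ΠT   : Ty → Ty → Ty

data Kind : Set where
  Type : Kind
  ΠK   : Ty → Kind → Kind

data Ar : Set where
  o   : Ar
  _⇒_ : Ar → Ar → Ar

erase : Ty → Ar
erase (atom P)  = o
erase (ΠT A B) = erase A ⇒ erase B

ext : (ℕ → ℕ) → ℕ → ℕ
ext ρ zero    = zero
ext ρ (suc i) = suc (ρ i)

mutual
  renTm : (ℕ → ℕ) → Tm → Tm
  renTm ρ (at R)  = at (renATm ρ R)
  renTm ρ (lam M) = lam (renTm (ext ρ) M)

  renATm : (ℕ → ℕ) → ATm → ATm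
  renATm ρ (con c)   = con c
  renATm ρ (var x)   = var (ρ x)
  renATm ρ (app R M) = app (renATm ρ R) (renTm ρ M)

mutual
  renATy : (ℕ → ℕ) → ATy → ATy
  renATy ρ (fam a)    = fam a
  renATy ρ (appT P M) = appT (renATy ρ P) (renTm ρ M)

  renTy : (ℕ → ℕ) → Ty → Ty
  renTy ρ (atom P)  = atom (renATy ρ P)
  renTy ρ (ΠT A B) = ΠT (renTy ρ A) (renTy (ext ρ) B)

-- A substitution assigns to each variable either a
-- triple-entry ⟨M , α⟩ (the variable is in the domain) or a variable
-- (the variable is not in the domain; it is kept, re-indexed).

data SubItem : Set where
  tm : Tm → Ar → SubItem
  vr : ℕ → SubItem

Sub : Set
Sub = ℕ → SubItem

-- pushing a substitution under a binder (the bound variable is not in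
-- the domain, and range terms are weakened so it is not free in them)
⇑ : Sub → Sub
⇑ σ zero = vr zero
⇑ σ (suc i) with σ i
... | tm M α = tm (renTm suc M) α
... | vr k   = vr (suc k)

-- simultaneous substitution for the innermost binders: the head of the
-- list is substituted for index 0, the next for index 1, ...;
-- remaining variables are kept (re-indexed).
multi : List (Tm × Ar) → Sub
multi []              j       = vr j
multi ((M , α) ∷ ps) zero    = tm M α
multi ((M , α) ∷ ps) (suc j) = multi ps j

single : Tm → Ar → Sub
single M α = multi ((M , α) ∷ [])

data ARes : Set where
  atm : ATm → ARes
  can : Tm → Ar → ARes

mutual
  data SubA : Sub → ATm → ARes → Set where
    s-var-in  : ∀ {σ x M α} → σ x ≡ tm M α → SubA σ (var x) (can M α)
    s-var-out : ∀ {σ x k} → σ x ≡ vr k → SubA σ (var x) (atm (var k))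
    s-con     : ∀ {σ c} → SubA σ (con c) (atm (con c))
    s-app-red : ∀ {σ R M M' M'' M''' α' α''} →
                SubA σ R (can (lam M') (α' ⇒ α'')) →
                SubC σ M M'' →
                SubC (single M'' α') M' M''' →
                SubA σ (app R M) (can M''' α'')
    s-app     : ∀ {σ R R' M M'} →
                SubA σ R (atm R') → SubC σ M M' →
                SubA σ (app R M) (atm (app R' M'))

  data SubC : Sub → Tm → Tm → Set where
    s-at    : ∀ {σ R R'} → SubA σ R (atm R') → SubC σ (at R) (at R')
    s-at-can : ∀ {σ R M' α'} → SubA σ R (can M' α') → SubC σ (at R) M'
    s-lam   : ∀ {σ M M'} → SubC (⇑ σ) M M' → SubC σ (lam M) (lam M')

data SubP : Sub → ATy → ATy → Set where
  s-fam  : ∀ {σ a} → SubP σ (fam a) (fam a)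
  s-appT : ∀ {σ P P' M M'} → SubP σ P P' → SubC σ M M' →
           SubP σ (appT P M) (appT P' M')

data SubTy : Sub → Ty → Ty → Set where
  s-atom : ∀ {σ P P'} → SubP σ P P' → SubTy σ (atom P) (atom P')
  s-Π    : ∀ {σ A A' B B'} → SubTy σ A A' → SubTy (⇑ σ) B B' →
           SubTy σ (ΠT A B) (ΠT A' B')

data SubK : Sub → Kind → Kind → Set where
  s-Type : ∀ {σ} → SubK σ Type Type
  s-ΠK   : ∀ {σ A A' K K'} → SubTy σ A A' → SubK (⇑ σ) K K' →
           SubK σ (ΠK A K) (ΠK A' K')

data Decl : Set where
  cdec : Name → Ty → Decl
  adec : Name → Kind → Decl

declName : Decl → Name
declName (cdec c A) = c
declName (adec a K) = a

data Sig : Set where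
  ·   : Sig
  _▹_ : Sig → Decl → Sig

data _∈Σ_ : Decl → Sig → Set where
  here  : ∀ {S d} → d ∈Σ (S ▹ d)
  there : ∀ {S d d'} → d ∈Σ S → d ∈Σ (S ▹ d')

names : Sig → List Name
names ·       = []
names (S ▹ d) = declName d ∷ names S

data Ctx : Set where
  ∅   : Ctx
  _,_ : Ctx → Ty → Ctx

-- x : A ∈ Γ  (types are weakened past the later entries)
data _∋_∶_ : Ctx → ℕ → Ty → Set where
  vz : ∀ {Γ A} → (Γ , A) ∋ zero ∶ renTy suc A
  vs : ∀ {Γ A B x} → Γ ∋ x ∶ B → (Γ , A) ∋ suc x ∶ renTy suc B

module LF (S : Sig) where
  mutual
    data ⊢_ctx : Ctx → Set where
      c-nil  : ⊢ ∅ ctx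
      c-cons : ∀ {Γ A} → ⊢ Γ ctx → Γ ⊢ A type → ⊢ (Γ , A) ctx

    data _⊢_kind : Ctx → Kind → Set where
      k-Type : ∀ {Γ} → Γ ⊢ Type kind
      k-Π    : ∀ {Γ A K} → Γ ⊢ A type → (Γ , A) ⊢ K kind → Γ ⊢ ΠK A K kind

    data _⊢_type : Ctx → Ty → Set where
      t-atom : ∀ {Γ P} → Γ ⊢ P ⇒K Type → Γ ⊢ atom P type
      t-Π    : ∀ {Γ A B} → Γ ⊢ A type → (Γ , A) ⊢ B type → Γ ⊢ ΠT A B type

    data _⊢_⇒K_ : Ctx → ATy → Kind → Set where
      p-fam : ∀ {Γ a K} → adec a K ∈Σ S → Γ ⊢ fam a ⇒K K
      p-app : ∀ {Γ P M A K₁ K} → Γ ⊢ P ⇒K ΠK A K₁ → Γ ⊢ M ⇐ A →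
              SubK (single M (erase A)) K₁ K → Γ ⊢ appT P M ⇒K K

    data _⊢_⇐_ : Ctx → Tm → Ty → Set where
      m-at  : ∀ {Γ R P} → Γ ⊢ R ⇒ atom P → Γ ⊢ at R ⇐ atom P
      m-lam : ∀ {Γ M A₁ A₂} → (Γ , A₁) ⊢ M ⇐ A₂ → Γ ⊢ lam M ⇐ ΠT A₁ A₂

    data _⊢_⇒_ : Ctx → ATm → Ty → Set where
      r-var : ∀ {Γ x A} → Γ ∋ x ∶ A → Γ ⊢ var x ⇒ A
      r-con : ∀ {Γ c A} → cdec c A ∈Σ S → Γ ⊢ con c ⇒ A
      r-app : ∀ {Γ R M A₁ A₂ A} → Γ ⊢ R ⇒ ΠT A₁ A₂ → Γ ⊢ M ⇐ A₁ →
              SubTy (single M (erase A₁)) A₂ A → Γ ⊢ app R M ⇒ A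

WfDecl : Sig → Decl → Set
WfDecl S (cdec c A) = LF._⊢_type S ∅ A
WfDecl S (adec a K) = LF._⊢_kind S ∅ K

data WfSig : Sig → Set where
  w-nil  : WfSig ·
  w-cons : ∀ {S d} → WfSig S → ¬ (declName d ∈ names S) → WfDecl S d →
           WfSig (S ▹ d)

piK : List Ty → Kind → Kind
piK []       K = K
piK (A ∷ As) K = ΠK A (piK As K)

appsT : ATy → List Tm → ATy
appsT P []       = P
appsT P (M ∷ Ms) = appsT (appT P M) Ms

-- the substitution {⟨y₁,M₁,A₁⁻⟩, …, ⟨y_k,M_k,A_k⁻⟩} acting on a phrase
-- lying under the binders y₁ … y_k (y_k innermost) of the telescope
prefixSub : ∀ {n} → Vec Tm n → Vec Ty n → ℕ → Sub
prefixSub Ms As k = multi (reverse (take k (toList (zip Ms (map erase As)))))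

module Submission where

-- The right-hand side is read off a derivation of Γ ⊢ P ⇒ K' by induction: each application
-- P M extends the telescope substitution {y₁ ↦ M₁, …} by one argument, and the kind it
-- produces, [M/x]([⇑σ]K), equals [σ, M/y]K because hereditary substitutions compose.
-- Conversely a derivation is rebuilt argument by argument, which needs the intermediate
-- kinds [σ](Πy:A.K) to exist.  Both directions therefore rest on the metatheory of
-- hereditary substitution on well-arity-typed phrases: it exists (the arity of the redex
-- decreases), is unique, commutes with renaming and composes, and it preserves LF typing,
-- which gives Γ ⊢ K' kind.

open import Defs
open import Data.Nat using (ℕ; zero; suc; _+_; _≤_; s≤s)
open import Data.Nat.Properties using (≤-refl; ≤-reflexive; ≤-trans; m≤m+n; m≤n+m; n≤1+n; <⇒≤; +-comm; +-monoˡ-≤)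
open import Data.List using (List; []; _∷_; _++_; take; reverse)
open import Data.List.Properties using (reverse-++)
open import Data.Fin using (Fin; toℕ; fromℕ; inject₁)
open import Data.Fin.Properties using (toℕ-fromℕ; toℕ-inject₁; toℕ<n)
open import Data.Vec using (Vec; []; _∷_; lookup; toList; zip; map; _∷ʳ_; initLast)
open import Data.Product using (_×_; _,_; proj₂; ∃; ∃-syntax)
open import Data.Sum using (_⊎_; inj₁; inj₂)
open import Data.Unit using (⊤; tt)
open import Function using (id; _∘_)
open import Function.Bundles using (_⇔_; mk⇔)
open import Relation.Binary.PropositionalEquality
  using (_≡_; _≗_; refl; sym; trans; cong; cong₂; subst; subst₂; module ≡-Reasoning)

-- Renaming

renKind : (ℕ → ℕ) → Kind → Kind
renKind ρ Type     = Type
renKind ρ (ΠK A K) = ΠK (renTy ρ A) (renKind (ext ρ) K)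

ext-∘ : ∀ {f g h} → f ∘ g ≗ h → ext f ∘ ext g ≗ ext h
ext-∘ e zero    = refl
ext-∘ e (suc x) = cong suc (e x)

mutual
  renTm-∘ : ∀ {f g h} → f ∘ g ≗ h → ∀ M → renTm f (renTm g M) ≡ renTm h M
  renTm-∘ e (at R)  = cong at (renATm-∘ e R)
  renTm-∘ e (lam M) = cong lam (renTm-∘ (ext-∘ e) M)

  renATm-∘ : ∀ {f g h} → f ∘ g ≗ h → ∀ R → renATm f (renATm g R) ≡ renATm h R
  renATm-∘ e (con c)   = refl
  renATm-∘ e (var x)   = cong var (e x)
  renATm-∘ e (app R M) = cong₂ app (renATm-∘ e R) (renTm-∘ e M)

renATy-∘ : ∀ {f g h} → f ∘ g ≗ h → ∀ P → renATy f (renATy g P) ≡ renATy h P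
renATy-∘ e (fam a)    = refl
renATy-∘ e (appT P M) = cong₂ appT (renATy-∘ e P) (renTm-∘ e M)

renTy-∘ : ∀ {f g h} → f ∘ g ≗ h → ∀ A → renTy f (renTy g A) ≡ renTy h A
renTy-∘ e (atom P) = cong atom (renATy-∘ e P)
renTy-∘ e (ΠT A B) = cong₂ ΠT (renTy-∘ e A) (renTy-∘ (ext-∘ e) B)

renTm-suc-ext : ∀ ρ M → renTm suc (renTm ρ M) ≡ renTm (ext ρ) (renTm suc M)
renTm-suc-ext ρ M = trans (renTm-∘ (λ _ → refl) M) (sym (renTm-∘ (λ _ → refl) M))

renTy-suc-ext : ∀ ρ A → renTy suc (renTy ρ A) ≡ renTy (ext ρ) (renTy suc A)
renTy-suc-ext ρ A = trans (renTy-∘ (λ _ → refl) A) (sym (renTy-∘ (λ _ → refl) A))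

ext-id : ∀ {f} → f ≗ id → ext f ≗ id
ext-id e zero    = refl
ext-id e (suc x) = cong suc (e x)

mutual
  renTm-id : ∀ {f} → f ≗ id → ∀ M → renTm f M ≡ M
  renTm-id e (at R)  = cong at (renATm-id e R)
  renTm-id e (lam M) = cong lam (renTm-id (ext-id e) M)

  renATm-id : ∀ {f} → f ≗ id → ∀ R → renATm f R ≡ R
  renATm-id e (con c)   = refl
  renATm-id e (var x)   = cong var (e x)
  renATm-id e (app R M) = cong₂ app (renATm-id e R) (renTm-id e M)

renATy-id : ∀ {f} → f ≗ id → ∀ P → renATy f P ≡ P
renATy-id e (fam a)    = refl
renATy-id e (appT P M) = cong₂ appT (renATy-id e P) (renTm-id e M)

renTy-id : ∀ {f} → f ≗ id → ∀ A → renTy f A ≡ A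
renTy-id e (atom P) = cong atom (renATy-id e P)
renTy-id e (ΠT A B) = cong₂ ΠT (renTy-id e A) (renTy-id (ext-id e) B)

erase-renTy : ∀ ρ A → erase (renTy ρ A) ≡ erase A
erase-renTy ρ (atom P) = refl
erase-renTy ρ (ΠT A B) = cong₂ _⇒_ (erase-renTy ρ A) (erase-renTy (ext ρ) B)

-- Hereditary substitution

renItem : (ℕ → ℕ) → SubItem → SubItem
renItem ρ (tm M α) = tm (renTm ρ M) α
renItem ρ (vr k)   = vr (ρ k)

renRes : (ℕ → ℕ) → ARes → ARes
renRes ρ (atm R)   = atm (renATm ρ R)
renRes ρ (can M α) = can (renTm ρ M) α

⇑-suc : ∀ σ x → ⇑ σ (suc x) ≡ renItem suc (σ x)
⇑-suc σ x with σ x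
... | tm M α = refl
... | vr k   = refl

renItem-suc-ext : ∀ ρ s → renItem suc (renItem ρ s) ≡ renItem (ext ρ) (renItem suc s)
renItem-suc-ext ρ (tm M α) = cong (λ N → tm N α) (renTm-suc-ext ρ M)
renItem-suc-ext ρ (vr k)   = refl

⇑-ren : ∀ {ρ₁ ρ₂ σ σ'} → σ' ∘ ρ₁ ≗ renItem ρ₂ ∘ σ → ⇑ σ' ∘ ext ρ₁ ≗ renItem (ext ρ₂) ∘ ⇑ σ
⇑-ren e zero = refl
⇑-ren {ρ₁} {ρ₂} {σ} {σ'} e (suc x) = begin
  ⇑ σ' (suc (ρ₁ x))                 ≡⟨ ⇑-suc σ' (ρ₁ x) ⟩
  renItem suc (σ' (ρ₁ x))           ≡⟨ cong (renItem suc) (e x) ⟩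
  renItem suc (renItem ρ₂ (σ x))    ≡⟨ renItem-suc-ext ρ₂ (σ x) ⟩
  renItem (ext ρ₂) (renItem suc (σ x)) ≡⟨ cong (renItem (ext ρ₂)) (sym (⇑-suc σ x)) ⟩
  renItem (ext ρ₂) (⇑ σ (suc x))    ∎
  where open ≡-Reasoning

single-ren : ∀ ρ M α → single (renTm ρ M) α ∘ ext ρ ≗ renItem ρ ∘ single M α
single-ren ρ M α zero    = refl
single-ren ρ M α (suc x) = refl

mutual
  SubC-ren : ∀ {ρ₁ ρ₂ σ σ' M M'} → σ' ∘ ρ₁ ≗ renItem ρ₂ ∘ σ →
             SubC σ M M' → SubC σ' (renTm ρ₁ M) (renTm ρ₂ M')
  SubC-ren e (s-at d)     = s-at (SubA-ren e d)
  SubC-ren e (s-at-can d) = s-at-can (SubA-ren e d)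
  SubC-ren e (s-lam d)    = s-lam (SubC-ren (⇑-ren e) d)

  SubA-ren : ∀ {ρ₁ ρ₂ σ σ' R r} → σ' ∘ ρ₁ ≗ renItem ρ₂ ∘ σ →
             SubA σ R r → SubA σ' (renATm ρ₁ R) (renRes ρ₂ r)
  SubA-ren {ρ₂ = ρ₂} e (s-var-in {x = x} eq)  = s-var-in (trans (e x) (cong (renItem ρ₂) eq))
  SubA-ren {ρ₂ = ρ₂} e (s-var-out {x = x} eq) = s-var-out (trans (e x) (cong (renItem ρ₂) eq))
  SubA-ren e s-con = s-con
  SubA-ren {ρ₂ = ρ₂} e (s-app-red {M'' = M''} {α' = α'} d₁ d₂ d₃) =
    s-app-red (SubA-ren e d₁) (SubC-ren e d₂) (SubC-ren (single-ren ρ₂ M'' α') d₃)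
  SubA-ren e (s-app d₁ d₂) = s-app (SubA-ren e d₁) (SubC-ren e d₂)

SubP-ren : ∀ {ρ₁ ρ₂ σ σ' P P'} → σ' ∘ ρ₁ ≗ renItem ρ₂ ∘ σ →
           SubP σ P P' → SubP σ' (renATy ρ₁ P) (renATy ρ₂ P')
SubP-ren e s-fam          = s-fam
SubP-ren e (s-appT d₁ d₂) = s-appT (SubP-ren e d₁) (SubC-ren e d₂)

SubTy-ren : ∀ {ρ₁ ρ₂ σ σ' A A'} → σ' ∘ ρ₁ ≗ renItem ρ₂ ∘ σ →
            SubTy σ A A' → SubTy σ' (renTy ρ₁ A) (renTy ρ₂ A')
SubTy-ren e (s-atom d)  = s-atom (SubP-ren e d)
SubTy-ren e (s-Π d₁ d₂) = s-Π (SubTy-ren e d₁) (SubTy-ren (⇑-ren e) d₂)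

SubK-ren : ∀ {ρ₁ ρ₂ σ σ' K K'} → σ' ∘ ρ₁ ≗ renItem ρ₂ ∘ σ →
           SubK σ K K' → SubK σ' (renKind ρ₁ K) (renKind ρ₂ K')
SubK-ren e s-Type       = s-Type
SubK-ren e (s-ΠK d₁ d₂) = s-ΠK (SubTy-ren e d₁) (SubK-ren (⇑-ren e) d₂)

⇑-id : ∀ {σ} → σ ≗ vr → ⇑ σ ≗ vr
⇑-id e zero = refl
⇑-id {σ} e (suc x) = trans (⇑-suc σ x) (cong (renItem suc) (e x))

mutual
  SubC-id : ∀ {σ} → σ ≗ vr → ∀ M → SubC σ M M
  SubC-id e (at R)  = s-at (SubA-id e R)
  SubC-id e (lam M) = s-lam (SubC-id (⇑-id e) M)

  SubA-id : ∀ {σ} → σ ≗ vr → ∀ R → SubA σ R (atm R)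
  SubA-id e (con c)   = s-con
  SubA-id e (var x)   = s-var-out (e x)
  SubA-id e (app R M) = s-app (SubA-id e R) (SubC-id e M)

SubP-id : ∀ {σ} → σ ≗ vr → ∀ P → SubP σ P P
SubP-id e (fam a)    = s-fam
SubP-id e (appT P M) = s-appT (SubP-id e P) (SubC-id e M)

SubTy-id : ∀ {σ} → σ ≗ vr → ∀ A → SubTy σ A A
SubTy-id e (atom P) = s-atom (SubP-id e P)
SubTy-id e (ΠT A B) = s-Π (SubTy-id e A) (SubTy-id (⇑-id e) B)

SubC-single-weaken : ∀ M α N → SubC (single M α) (renTm suc N) N
SubC-single-weaken M α N =
  subst (SubC (single M α) (renTm suc N)) (renTm-id (λ _ → refl) N)
        (SubC-ren {ρ₂ = id} (λ _ → refl) (SubC-id (λ _ → refl) N))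

SubTy-single-weaken : ∀ M α A → SubTy (single M α) (renTy suc A) A
SubTy-single-weaken M α A =
  subst (SubTy (single M α) (renTy suc A)) (renTy-id (λ _ → refl) A)
        (SubTy-ren {ρ₂ = id} (λ _ → refl) (SubTy-id (λ _ → refl) A))

SubC-⇑-weaken : ∀ {τ M M'} → SubC τ M M' → SubC (⇑ τ) (renTm suc M) (renTm suc M')
SubC-⇑-weaken {τ} = SubC-ren (⇑-suc τ)

SubTy-⇑-weaken : ∀ {τ A A'} → SubTy τ A A' → SubTy (⇑ τ) (renTy suc A) (renTy suc A')
SubTy-⇑-weaken {τ} = SubTy-ren (⇑-suc τ)

tm-injective : ∀ {M N α β} → tm M α ≡ tm N β → M ≡ N × α ≡ β
tm-injective refl = refl , refl

mutual
  SubC-det : ∀ {σ M M₁ M₂} → SubC σ M M₁ → SubC σ M M₂ → M₁ ≡ M₂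
  SubC-det (s-at d) (s-at e) with SubA-det d e
  ... | refl = refl
  SubC-det (s-at d) (s-at-can e) with SubA-det d e
  ... | ()
  SubC-det (s-at-can d) (s-at e) with SubA-det d e
  ... | ()
  SubC-det (s-at-can d) (s-at-can e) with SubA-det d e
  ... | refl = refl
  SubC-det (s-lam d) (s-lam e) = cong lam (SubC-det d e)

  SubA-det : ∀ {σ R r₁ r₂} → SubA σ R r₁ → SubA σ R r₂ → r₁ ≡ r₂
  SubA-det (s-var-in e₁) (s-var-in e₂) with tm-injective (trans (sym e₁) e₂)
  ... | refl , refl = refl
  SubA-det (s-var-in e₁) (s-var-out e₂) with trans (sym e₁) e₂
  ... | ()
  SubA-det (s-var-out e₁) (s-var-in e₂) with trans (sym e₁) e₂
  ... | ()
  SubA-det (s-var-out e₁) (s-var-out e₂) with trans (sym e₁) e₂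
  ... | refl = refl
  SubA-det s-con s-con = refl
  SubA-det (s-app-red d₁ d₂ d₃) (s-app-red e₁ e₂ e₃) with SubA-det d₁ e₁ | SubC-det d₂ e₂
  ... | refl | refl = cong (λ N → can N _) (SubC-det d₃ e₃)
  SubA-det (s-app-red d₁ d₂ d₃) (s-app e₁ e₂) with SubA-det d₁ e₁
  ... | ()
  SubA-det (s-app d₁ d₂) (s-app-red e₁ e₂ e₃) with SubA-det d₁ e₁
  ... | ()
  SubA-det (s-app d₁ d₂) (s-app e₁ e₂) with SubA-det d₁ e₁ | SubC-det d₂ e₂
  ... | refl | refl = refl

SubP-det : ∀ {σ P P₁ P₂} → SubP σ P P₁ → SubP σ P P₂ → P₁ ≡ P₂
SubP-det s-fam          s-fam          = refl
SubP-det (s-appT d₁ d₂) (s-appT e₁ e₂) = cong₂ appT (SubP-det d₁ e₁) (SubC-det d₂ e₂)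

SubTy-det : ∀ {σ A A₁ A₂} → SubTy σ A A₁ → SubTy σ A A₂ → A₁ ≡ A₂
SubTy-det (s-atom d)  (s-atom e)  = cong atom (SubP-det d e)
SubTy-det (s-Π d₁ d₂) (s-Π e₁ e₂) = cong₂ ΠT (SubTy-det d₁ e₁) (SubTy-det d₂ e₂)

SubK-det : ∀ {σ K K₁ K₂} → SubK σ K K₁ → SubK σ K K₂ → K₁ ≡ K₂
SubK-det s-Type       s-Type       = refl
SubK-det (s-ΠK d₁ d₂) (s-ΠK e₁ e₂) = cong₂ ΠK (SubTy-det d₁ e₁) (SubK-det d₂ e₂)

erase-SubTy : ∀ {σ A A'} → SubTy σ A A' → erase A' ≡ erase A
erase-SubTy (s-atom d)  = refl
erase-SubTy (s-Π d₁ d₂) = cong₂ _⇒_ (erase-SubTy d₁) (erase-SubTy d₂)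

-- The simply typed skeleton of LF over arity types.  Well-arity-typedness is the invariant
-- on which hereditary substitution is total.

data _∋a_∶_ : List Ar → ℕ → Ar → Set where
  here  : ∀ {Δ α} → (α ∷ Δ) ∋a zero ∶ α
  there : ∀ {Δ x α β} → Δ ∋a x ∶ α → (β ∷ Δ) ∋a suc x ∶ α

mutual
  data _⊢c_∶_ : List Ar → Tm → Ar → Set where
    at-ar  : ∀ {Δ R} → Δ ⊢a R ∶ o → Δ ⊢c at R ∶ o
    lam-ar : ∀ {Δ M α β} → (α ∷ Δ) ⊢c M ∶ β → Δ ⊢c lam M ∶ (α ⇒ β)

  data _⊢a_∶_ : List Ar → ATm → Ar → Set where
    var-ar : ∀ {Δ x α} → Δ ∋a x ∶ α → Δ ⊢a var x ∶ α
    con-ar : ∀ {Δ c α} → Δ ⊢a con c ∶ α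
    app-ar : ∀ {Δ R M α β} → Δ ⊢a R ∶ (α ⇒ β) → Δ ⊢c M ∶ α → Δ ⊢a app R M ∶ β

data _⊢p_ : List Ar → ATy → Set where
  fam-ar  : ∀ {Δ a} → Δ ⊢p fam a
  appT-ar : ∀ {Δ P M α} → Δ ⊢p P → Δ ⊢c M ∶ α → Δ ⊢p appT P M

data _⊢t_ : List Ar → Ty → Set where
  atom-ar : ∀ {Δ P} → Δ ⊢p P → Δ ⊢t atom P
  Π-ar    : ∀ {Δ A B} → Δ ⊢t A → (erase A ∷ Δ) ⊢t B → Δ ⊢t ΠT A B

data _⊢k_ : List Ar → Kind → Set where
  Type-ar : ∀ {Δ} → Δ ⊢k Type
  ΠK-ar   : ∀ {Δ A K} → Δ ⊢t A → (erase A ∷ Δ) ⊢k K → Δ ⊢k ΠK A K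

ArRen : (ℕ → ℕ) → List Ar → List Ar → Set
ArRen ρ Δ₁ Δ₂ = ∀ {x α} → Δ₁ ∋a x ∶ α → Δ₂ ∋a ρ x ∶ α

ArRen-ext : ∀ {ρ Δ₁ Δ₂ β} → ArRen ρ Δ₁ Δ₂ → ArRen (ext ρ) (β ∷ Δ₁) (β ∷ Δ₂)
ArRen-ext r here      = here
ArRen-ext r (there p) = there (r p)

mutual
  ⊢c-ren : ∀ {ρ Δ₁ Δ₂ M α} → ArRen ρ Δ₁ Δ₂ → Δ₁ ⊢c M ∶ α → Δ₂ ⊢c renTm ρ M ∶ α
  ⊢c-ren r (at-ar p)  = at-ar (⊢a-ren r p)
  ⊢c-ren r (lam-ar p) = lam-ar (⊢c-ren (ArRen-ext r) p)

  ⊢a-ren : ∀ {ρ Δ₁ Δ₂ R α} → ArRen ρ Δ₁ Δ₂ → Δ₁ ⊢a R ∶ α → Δ₂ ⊢a renATm ρ R ∶ α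
  ⊢a-ren r (var-ar p)   = var-ar (r p)
  ⊢a-ren r con-ar       = con-ar
  ⊢a-ren r (app-ar p q) = app-ar (⊢a-ren r p) (⊢c-ren r q)

⊢p-ren : ∀ {ρ Δ₁ Δ₂ P} → ArRen ρ Δ₁ Δ₂ → Δ₁ ⊢p P → Δ₂ ⊢p renATy ρ P
⊢p-ren r fam-ar        = fam-ar
⊢p-ren r (appT-ar p q) = appT-ar (⊢p-ren r p) (⊢c-ren r q)

⊢t-ren : ∀ {ρ Δ₁ Δ₂ A} → ArRen ρ Δ₁ Δ₂ → Δ₁ ⊢t A → Δ₂ ⊢t renTy ρ A
⊢t-ren r (atom-ar p) = atom-ar (⊢p-ren r p)
⊢t-ren {ρ} {A = ΠT A B} r (Π-ar p q) =
  Π-ar (⊢t-ren r p) (subst (λ α → (α ∷ _) ⊢t renTy (ext ρ) B) (sym (erase-renTy ρ A)) (⊢t-ren (ArRen-ext r) q))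

⊢k-ren : ∀ {ρ Δ₁ Δ₂ K} → ArRen ρ Δ₁ Δ₂ → Δ₁ ⊢k K → Δ₂ ⊢k renKind ρ K
⊢k-ren r Type-ar = Type-ar
⊢k-ren {ρ} {K = ΠK A K} r (ΠK-ar p q) =
  ΠK-ar (⊢t-ren r p) (subst (λ α → (α ∷ _) ⊢k renKind (ext ρ) K) (sym (erase-renTy ρ A)) (⊢k-ren (ArRen-ext r) q))

Fixes : (ℕ → ℕ) → List Ar → Set
Fixes ρ Δ = ∀ {x α} → Δ ∋a x ∶ α → ρ x ≡ x

Fixes-ext : ∀ {ρ Δ β} → Fixes ρ Δ → Fixes (ext ρ) (β ∷ Δ)
Fixes-ext r here      = refl
Fixes-ext r (there p) = cong suc (r p)

mutual
  renTm-fixes : ∀ {ρ Δ M α} → Fixes ρ Δ → Δ ⊢c M ∶ α → renTm ρ M ≡ M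
  renTm-fixes r (at-ar p)  = cong at (renATm-fixes r p)
  renTm-fixes r (lam-ar p) = cong lam (renTm-fixes (Fixes-ext r) p)

  renATm-fixes : ∀ {ρ Δ R α} → Fixes ρ Δ → Δ ⊢a R ∶ α → renATm ρ R ≡ R
  renATm-fixes r (var-ar p)   = cong var (r p)
  renATm-fixes r con-ar       = refl
  renATm-fixes r (app-ar p q) = cong₂ app (renATm-fixes r p) (renTm-fixes r q)

renATy-fixes : ∀ {ρ Δ P} → Fixes ρ Δ → Δ ⊢p P → renATy ρ P ≡ P
renATy-fixes r fam-ar        = refl
renATy-fixes r (appT-ar p q) = cong₂ appT (renATy-fixes r p) (renTm-fixes r q)

renTy-fixes : ∀ {ρ Δ A} → Fixes ρ Δ → Δ ⊢t A → renTy ρ A ≡ A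
renTy-fixes r (atom-ar p) = cong atom (renATy-fixes r p)
renTy-fixes r (Π-ar p q)  = cong₂ ΠT (renTy-fixes r p) (renTy-fixes (Fixes-ext r) q)

renKind-fixes : ∀ {ρ Δ K} → Fixes ρ Δ → Δ ⊢k K → renKind ρ K ≡ K
renKind-fixes r Type-ar     = refl
renKind-fixes r (ΠK-ar p q) = cong₂ ΠK (renTy-fixes r p) (renKind-fixes (Fixes-ext r) q)

⊢t-closed : ∀ {Δ A} → [] ⊢t A → Δ ⊢t A
⊢t-closed p = subst (_ ⊢t_) (renTy-fixes {ρ = id} (λ ()) p) (⊢t-ren (λ ()) p)

⊢k-closed : ∀ {Δ K} → [] ⊢k K → Δ ⊢k K
⊢k-closed p = subst (_ ⊢k_) (renKind-fixes {ρ = id} (λ ()) p) (⊢k-ren (λ ()) p)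

IdOn : Sub → List Ar → Set
IdOn σ Δ = ∀ {x α} → Δ ∋a x ∶ α → σ x ≡ vr x

IdOn-⇑ : ∀ {σ Δ β} → IdOn σ Δ → IdOn (⇑ σ) (β ∷ Δ)
IdOn-⇑ e here = refl
IdOn-⇑ {σ} e (there {x = x} p) = trans (⇑-suc σ x) (cong (renItem suc) (e p))

mutual
  SubC-idOn : ∀ {σ Δ M α} → IdOn σ Δ → Δ ⊢c M ∶ α → SubC σ M M
  SubC-idOn e (at-ar p)  = s-at (SubA-idOn e p)
  SubC-idOn e (lam-ar p) = s-lam (SubC-idOn (IdOn-⇑ e) p)

  SubA-idOn : ∀ {σ Δ R α} → IdOn σ Δ → Δ ⊢a R ∶ α → SubA σ R (atm R)
  SubA-idOn e (var-ar p)   = s-var-out (e p)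
  SubA-idOn e con-ar       = s-con
  SubA-idOn e (app-ar p q) = s-app (SubA-idOn e p) (SubC-idOn e q)

SubP-idOn : ∀ {σ Δ P} → IdOn σ Δ → Δ ⊢p P → SubP σ P P
SubP-idOn e fam-ar        = s-fam
SubP-idOn e (appT-ar p q) = s-appT (SubP-idOn e p) (SubC-idOn e q)

SubTy-idOn : ∀ {σ Δ A} → IdOn σ Δ → Δ ⊢t A → SubTy σ A A
SubTy-idOn e (atom-ar p) = s-atom (SubP-idOn e p)
SubTy-idOn e (Π-ar p q)  = s-Π (SubTy-idOn e p) (SubTy-idOn (IdOn-⇑ e) q)

SubK-idOn : ∀ {σ Δ K} → IdOn σ Δ → Δ ⊢k K → SubK σ K K
SubK-idOn e Type-ar     = s-Type
SubK-idOn e (ΠK-ar p q) = s-ΠK (SubTy-idOn e p) (SubK-idOn (IdOn-⇑ e) q)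

SubTy-closed : ∀ {σ A} → [] ⊢t A → SubTy σ A A
SubTy-closed = SubTy-idOn (λ ())

SubK-closed : ∀ {σ K} → [] ⊢k K → SubK σ K K
SubK-closed = SubK-idOn (λ ())

ItemOk : List Ar → SubItem → Ar → Set
ItemOk Δ (tm M β) α = β ≡ α × Δ ⊢c M ∶ α
ItemOk Δ (vr k)   α = Δ ∋a k ∶ α

ArSub : Sub → List Ar → List Ar → Set
ArSub σ Δ₁ Δ₂ = ∀ {x α} → Δ₁ ∋a x ∶ α → ItemOk Δ₂ (σ x) α

ArSub-cong : ∀ {σ τ Δ₁ Δ₂} → σ ≗ τ → ArSub σ Δ₁ Δ₂ → ArSub τ Δ₁ Δ₂
ArSub-cong {Δ₂ = Δ₂} e t {x} {α} p = subst (λ s → ItemOk Δ₂ s α) (e x) (t p)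

ItemOk-weaken : ∀ {Δ β} s {α} → ItemOk Δ s α → ItemOk (β ∷ Δ) (renItem suc s) α
ItemOk-weaken (tm M γ) (e , p) = e , ⊢c-ren there p
ItemOk-weaken (vr k)   p       = there p

ArSub-⇑ : ∀ {σ Δ₁ Δ₂ β} → ArSub σ Δ₁ Δ₂ → ArSub (⇑ σ) (β ∷ Δ₁) (β ∷ Δ₂)
ArSub-⇑ t here = here
ArSub-⇑ {σ} {β = β} t (there {x = x} {α = α} p) =
  subst (λ s → ItemOk (β ∷ _) s α) (sym (⇑-suc σ x)) (ItemOk-weaken (σ x) (t p))

ArSub-single : ∀ {Δ N α} → Δ ⊢c N ∶ α → ArSub (single N α) (α ∷ Δ) Δ
ArSub-single q here      = refl , q
ArSub-single q (there p) = p

extend : Tm → Ar → Sub → Sub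
extend N α σ zero    = tm N α
extend N α σ (suc x) = σ x

ArSub-extend : ∀ {σ Δ₁ Δ₂ M α} → ArSub σ Δ₁ Δ₂ → Δ₂ ⊢c M ∶ α → ArSub (extend M α σ) (α ∷ Δ₁) Δ₂
ArSub-extend t q here      = refl , q
ArSub-extend t q (there p) = t p

size : Ar → ℕ
size o       = zero
size (α ⇒ β) = suc (size α + size β)

ItemBounded : ℕ → SubItem → Set
ItemBounded n (tm M α) = size α ≤ n
ItemBounded n (vr k)   = ⊤

Bounded : ℕ → Sub → Set
Bounded n σ = ∀ x → ItemBounded n (σ x)

Bounded-cong : ∀ {σ τ n} → σ ≗ τ → Bounded n σ → Bounded n τ
Bounded-cong {n = n} e b x = subst (ItemBounded n) (e x) (b x)

Bounded-mono : ∀ {m n σ} → m ≤ n → Bounded m σ → Bounded n σ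
Bounded-mono {σ = σ} le b x with σ x | b x
... | tm M α | c = ≤-trans c le
... | vr k   | c = tt

Bounded-⇑ : ∀ {n σ} → Bounded n σ → Bounded n (⇑ σ)
Bounded-⇑ b zero = tt
Bounded-⇑ {n} {σ} b (suc x) = subst (ItemBounded n) (sym (⇑-suc σ x)) (weaken (σ x) (b x))
  where
    weaken : ∀ s → ItemBounded n s → ItemBounded n (renItem suc s)
    weaken (tm M α) c = c
    weaken (vr k)   c = tt

Bounded-single : ∀ {N α} → Bounded (size α) (single N α)
Bounded-single zero    = ≤-refl
Bounded-single (suc x) = tt

Bounded-extend : ∀ {σ n M α} → Bounded n σ → Bounded (size α + n) (extend M α σ)
Bounded-extend {n = n} {α = α} b zero = m≤m+n (size α) n
Bounded-extend {n = n} {α = α} b (suc x) = Bounded-mono (m≤n+m n (size α)) b x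

ResOk : List Ar → ARes → Ar → Set
ResOk Δ (atm R)   α = Δ ⊢a R ∶ α
ResOk Δ (can M β) α = β ≡ α × Δ ⊢c M ∶ α

ItemOk-tm : ∀ {Δ s M β α} → s ≡ tm M β → ItemOk Δ s α → β ≡ α × Δ ⊢c M ∶ α
ItemOk-tm refl t = t

ItemOk-vr : ∀ {Δ s k α} → s ≡ vr k → ItemOk Δ s α → Δ ∋a k ∶ α
ItemOk-vr refl t = t

mutual
  ⊢c-sub : ∀ {σ Δ₁ Δ₂ M M' α} → ArSub σ Δ₁ Δ₂ → Δ₁ ⊢c M ∶ α → SubC σ M M' → Δ₂ ⊢c M' ∶ α
  ⊢c-sub t (at-ar p)  (s-at d)     = at-ar (⊢a-sub t p d)
  ⊢c-sub t (at-ar p)  (s-at-can d) = proj₂ (⊢a-sub t p d)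
  ⊢c-sub t (lam-ar p) (s-lam d)    = lam-ar (⊢c-sub (ArSub-⇑ t) p d)

  ⊢a-sub : ∀ {σ Δ₁ Δ₂ R r α} → ArSub σ Δ₁ Δ₂ → Δ₁ ⊢a R ∶ α → SubA σ R r → ResOk Δ₂ r α
  ⊢a-sub t (var-ar p) (s-var-in eq)  = ItemOk-tm eq (t p)
  ⊢a-sub t (var-ar p) (s-var-out eq) = var-ar (ItemOk-vr eq (t p))
  ⊢a-sub t con-ar     s-con          = con-ar
  ⊢a-sub t (app-ar p q) (s-app-red d₁ d₂ d₃) with ⊢a-sub t p d₁
  ... | refl , lam-ar pB = refl , ⊢c-sub (ArSub-single (⊢c-sub t q d₂)) pB d₃
  ⊢a-sub t (app-ar p q) (s-app d₁ d₂) = app-ar (⊢a-sub t p d₁) (⊢c-sub t q d₂)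

⊢p-sub : ∀ {σ Δ₁ Δ₂ P P'} → ArSub σ Δ₁ Δ₂ → Δ₁ ⊢p P → SubP σ P P' → Δ₂ ⊢p P'
⊢p-sub t fam-ar        s-fam          = fam-ar
⊢p-sub t (appT-ar p q) (s-appT d₁ d₂) = appT-ar (⊢p-sub t p d₁) (⊢c-sub t q d₂)

⊢t-sub : ∀ {σ Δ₁ Δ₂ A A'} → ArSub σ Δ₁ Δ₂ → Δ₁ ⊢t A → SubTy σ A A' → Δ₂ ⊢t A'
⊢t-sub t (atom-ar p) (s-atom d)  = atom-ar (⊢p-sub t p d)
⊢t-sub t (Π-ar p q)  (s-Π d₁ d₂) =
  Π-ar (⊢t-sub t p d₁) (subst (λ α → (α ∷ _) ⊢t _) (sym (erase-SubTy d₁)) (⊢t-sub (ArSub-⇑ t) q d₂))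

⊢k-sub : ∀ {σ Δ₁ Δ₂ K K'} → ArSub σ Δ₁ Δ₂ → Δ₁ ⊢k K → SubK σ K K' → Δ₂ ⊢k K'
⊢k-sub t Type-ar     s-Type       = Type-ar
⊢k-sub t (ΠK-ar p q) (s-ΠK d₁ d₂) =
  ΠK-ar (⊢t-sub t p d₁) (subst (λ α → (α ∷ _) ⊢k _) (sym (erase-SubTy d₁)) (⊢k-sub (ArSub-⇑ t) q d₂))

-- The arity of a canonical result is bounded by that of an entry of σ; a redex at arity
-- α ⇒ β continues at the strictly smaller bound size α.
SubA-result : Sub → ATm → Ar → ℕ → Set
SubA-result σ R α n = (∃ λ R' → SubA σ R (atm R')) ⊎ (∃ λ M' → SubA σ R (can M' α) × size α ≤ n)

mutual
  SubC-exists : ∀ n {σ Δ₁ Δ₂ M α} → Bounded n σ → ArSub σ Δ₁ Δ₂ → Δ₁ ⊢c M ∶ α → ∃ λ M' → SubC σ M M'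
  SubC-exists n b t (at-ar p) with SubA-exists n b t p
  ... | inj₁ (R' , d)     = at R' , s-at d
  ... | inj₂ (M' , d , _) = M' , s-at-can d
  SubC-exists n b t (lam-ar p) with SubC-exists n (Bounded-⇑ b) (ArSub-⇑ t) p
  ... | M' , d = lam M' , s-lam d

  SubA-exists : ∀ n {σ Δ₁ Δ₂ R α} → Bounded n σ → ArSub σ Δ₁ Δ₂ → Δ₁ ⊢a R ∶ α → SubA-result σ R α n
  SubA-exists n {σ} b t (var-ar {x = x} p) = var-result (σ x) refl (t p) (b x)
    where
      var-result : ∀ {Δ α} s → σ x ≡ s → ItemOk Δ s α → ItemBounded n s → SubA-result σ (var x) α n
      var-result (tm M β) eq (refl , _) c = inj₂ (M , s-var-in eq , c)
      var-result (vr k)   eq _          _ = inj₁ (var k , s-var-out eq)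
  SubA-exists n b t con-ar = inj₁ (_ , s-con)
  SubA-exists n b t (app-ar p q) with SubA-exists n b t p | SubC-exists n b t q
  ... | inj₁ (R' , d)      | N' , dN = inj₁ (app R' N' , s-app d dN)
  ... | inj₂ (M' , d , le) | N' , dN = redex-exists n le (proj₂ (⊢a-sub t p d)) d dN (⊢c-sub t q dN)

  redex-exists : ∀ n {σ Δ₂ R M α β M' N'} → size (α ⇒ β) ≤ n → Δ₂ ⊢c M' ∶ (α ⇒ β) →
                 SubA σ R (can M' (α ⇒ β)) → SubC σ M N' → Δ₂ ⊢c N' ∶ α → SubA-result σ (app R M) β n
  redex-exists (suc n) {α = α} {β = β} (s≤s le) (lam-ar pB) d dN pN
    with SubC-exists n (Bounded-mono (≤-trans (m≤m+n (size α) (size β)) le) Bounded-single) (ArSub-single pN) pB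
  ... | E , dE = inj₂ (E , s-app-red d dN dE , ≤-trans (m≤n+m (size β) (size α)) (≤-trans le (n≤1+n n)))

SubP-exists : ∀ n {σ Δ₁ Δ₂ P} → Bounded n σ → ArSub σ Δ₁ Δ₂ → Δ₁ ⊢p P → ∃ λ P' → SubP σ P P'
SubP-exists n b t fam-ar = _ , s-fam
SubP-exists n b t (appT-ar p q) with SubP-exists n b t p | SubC-exists n b t q
... | P' , d | M' , e = appT P' M' , s-appT d e

SubTy-exists : ∀ n {σ Δ₁ Δ₂ A} → Bounded n σ → ArSub σ Δ₁ Δ₂ → Δ₁ ⊢t A → ∃ λ A' → SubTy σ A A'
SubTy-exists n b t (atom-ar p) with SubP-exists n b t p
... | P' , d = atom P' , s-atom d
SubTy-exists n b t (Π-ar p q) with SubTy-exists n b t p | SubTy-exists n (Bounded-⇑ b) (ArSub-⇑ t) q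
... | A' , d | B' , e = ΠT A' B' , s-Π d e

SubK-exists : ∀ n {σ Δ₁ Δ₂ K} → Bounded n σ → ArSub σ Δ₁ Δ₂ → Δ₁ ⊢k K → ∃ λ K' → SubK σ K K'
SubK-exists n b t Type-ar = Type , s-Type
SubK-exists n b t (ΠK-ar p q) with SubTy-exists n b t p | SubK-exists n (Bounded-⇑ b) (ArSub-⇑ t) q
... | A' , d | K' , e = ΠK A' K' , s-ΠK d e

-- Composite σ τ ρ: ρ is σ followed by τ, pointwise.
ItemComp : Sub → SubItem → SubItem → Set
ItemComp τ (tm M α) r = ∃ λ M' → r ≡ tm M' α × SubC τ M M'
ItemComp τ (vr k)   r = r ≡ τ k

Composite : Sub → Sub → Sub → Set
Composite σ τ ρ = ∀ x → ItemComp τ (σ x) (ρ x)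

Composite-cong : ∀ {σ τ ρ ρ'} → ρ ≗ ρ' → Composite σ τ ρ → Composite σ τ ρ'
Composite-cong {σ} {τ} e c x = subst (ItemComp τ (σ x)) (e x) (c x)

Composite-⇑ : ∀ {σ τ ρ} → Composite σ τ ρ → Composite (⇑ σ) (⇑ τ) (⇑ ρ)
Composite-⇑ c zero = refl
Composite-⇑ {σ} {τ} {ρ} c (suc x) =
  subst₂ (ItemComp (⇑ τ)) (sym (⇑-suc σ x)) (sym (⇑-suc ρ x)) (weaken (σ x) (ρ x) (c x))
  where
    weaken : ∀ s r → ItemComp τ s r → ItemComp (⇑ τ) (renItem suc s) (renItem suc r)
    weaken (tm M α) r (M' , refl , d) = renTm suc M' , refl , SubC-⇑-weaken d
    weaken (vr k)   r refl            = sym (⇑-suc τ k)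

Composite-single : ∀ {τ N N' α} → SubC τ N N' → Composite (single N α) τ (extend N' α τ)
Composite-single e zero    = _ , refl , e
Composite-single e (suc x) = refl

Composite-⇑-single : ∀ {τ N α} → Composite (⇑ τ) (single N α) (extend N α τ)
Composite-⇑-single zero = refl
Composite-⇑-single {τ} {N} {α} (suc x) =
  subst (λ s → ItemComp (single N α) s (τ x)) (sym (⇑-suc τ x)) (weakened (τ x))
  where
    weakened : ∀ s → ItemComp (single N α) (renItem suc s) s
    weakened (tm M β) = M , refl , SubC-single-weaken N α M
    weakened (vr k)   = refl

-- m bounds the total arity size of σ and τ; it decreases exactly when a redex is reduced.
record CompEnv (σ τ ρ : Sub) (Δ₁ Δ₂ Δ₃ : List Ar) (m : ℕ) : Set where
  field
    nσ nτ     : ℕ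
    nσ+nτ≤m   : nσ + nτ ≤ m
    bounded-σ : Bounded nσ σ
    bounded-τ : Bounded nτ τ
    ar-σ      : ArSub σ Δ₁ Δ₂
    ar-τ      : ArSub τ Δ₂ Δ₃
    composite : Composite σ τ ρ
open CompEnv

CompEnv-⇑ : ∀ {σ τ ρ Δ₁ Δ₂ Δ₃ m β} → CompEnv σ τ ρ Δ₁ Δ₂ Δ₃ m →
            CompEnv (⇑ σ) (⇑ τ) (⇑ ρ) (β ∷ Δ₁) (β ∷ Δ₂) (β ∷ Δ₃) m
CompEnv-⇑ env = record
  { nσ = nσ env ; nτ = nτ env ; nσ+nτ≤m = nσ+nτ≤m env
  ; bounded-σ = Bounded-⇑ (bounded-σ env) ; bounded-τ = Bounded-⇑ (bounded-τ env)
  ; ar-σ = ArSub-⇑ (ar-σ env) ; ar-τ = ArSub-⇑ (ar-τ env) ; composite = Composite-⇑ (composite env) }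

CompEnv-single : ∀ {σ Δ₁ Δ₂ n m N N' α} → Bounded n σ → ArSub σ Δ₁ Δ₂ → Δ₁ ⊢c N ∶ α →
                 SubC σ N N' → size α + n ≤ m → CompEnv (single N α) σ (extend N' α σ) (α ∷ Δ₁) Δ₁ Δ₂ m
CompEnv-single {n = n} {α = α} b t pN dN le = record
  { nσ = size α ; nτ = n ; nσ+nτ≤m = le ; bounded-σ = Bounded-single ; bounded-τ = b
  ; ar-σ = ArSub-single pN ; ar-τ = t ; composite = Composite-single dN }

CompEnv-⇑-single : ∀ {σ ρ Δ₁ Δ₂ n m N α} → Bounded n σ → ArSub σ Δ₁ Δ₂ → Δ₂ ⊢c N ∶ α →
                   extend N α σ ≗ ρ → n + size α ≤ m →
                   CompEnv (⇑ σ) (single N α) ρ (α ∷ Δ₁) (α ∷ Δ₂) Δ₂ m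
CompEnv-⇑-single {n = n} {α = α} b t pN e le = record
  { nσ = n ; nτ = size α ; nσ+nτ≤m = le ; bounded-σ = Bounded-⇑ b ; bounded-τ = Bounded-single
  ; ar-σ = ArSub-⇑ t ; ar-τ = ArSub-single pN ; composite = Composite-cong e Composite-⇑-single }

SubA-can-bounded : ∀ {n σ R M γ} → Bounded n σ → SubA σ R (can M γ) → size γ ≤ n
SubA-can-bounded {n} {σ} b (s-var-in {x = x} eq) = from-entry (σ x) eq (b x)
  where
    from-entry : ∀ {M γ} s → s ≡ tm M γ → ItemBounded n s → size γ ≤ n
    from-entry s refl c = c
SubA-can-bounded b (s-app-red {α' = α'} {α'' = α''} d₁ d₂ d₃) =
  ≤-trans (≤-trans (m≤n+m (size α'') (size α')) (n≤1+n _)) (SubA-can-bounded b d₁)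

SubA-comp-result : Sub → Sub → ATm → ARes → Set
SubA-comp-result τ ρ R (atm R₁)   = ∀ {r₂} → SubA τ R₁ r₂ → SubA ρ R r₂
SubA-comp-result τ ρ R (can M₁ γ) = ∀ {M₂} → SubC τ M₁ M₂ → SubA ρ R (can M₂ γ)

ItemComp-tm : ∀ {τ s r M α M₂} → s ≡ tm M α → ItemComp τ s r → SubC τ M M₂ → r ≡ tm M₂ α
ItemComp-tm refl (M' , refl , d) e = cong (λ N → tm N _) (SubC-det d e)

ItemComp-vr : ∀ {τ s r k} → s ≡ vr k → ItemComp τ s r → r ≡ τ k
ItemComp-vr refl c = c

mutual
  SubC-comp : ∀ {m σ τ ρ Δ₁ Δ₂ Δ₃ E E₁ E₂ β} → CompEnv σ τ ρ Δ₁ Δ₂ Δ₃ m → Δ₁ ⊢c E ∶ β →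
              SubC σ E E₁ → SubC τ E₁ E₂ → SubC ρ E E₂
  SubC-comp env (at-ar p)  (s-at d)     (s-at e)     = s-at (SubA-comp env p d e)
  SubC-comp env (at-ar p)  (s-at d)     (s-at-can e) = s-at-can (SubA-comp env p d e)
  SubC-comp env (at-ar p)  (s-at-can d) e            = s-at-can (SubA-comp env p d e)
  SubC-comp env (lam-ar p) (s-lam d)    (s-lam e)    = s-lam (SubC-comp (CompEnv-⇑ env) p d e)

  SubA-comp : ∀ {m σ τ ρ Δ₁ Δ₂ Δ₃ R r₁ β} → CompEnv σ τ ρ Δ₁ Δ₂ Δ₃ m → Δ₁ ⊢a R ∶ β →
              SubA σ R r₁ → SubA-comp-result τ ρ R r₁
  SubA-comp env (var-ar p) (s-var-in {x = x} eq) e = s-var-in (ItemComp-tm eq (composite env x) e)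
  SubA-comp env (var-ar p) (s-var-out {x = x} eq) (s-var-in e) =
    s-var-in (trans (ItemComp-vr eq (composite env x)) e)
  SubA-comp env (var-ar p) (s-var-out {x = x} eq) (s-var-out e) =
    s-var-out (trans (ItemComp-vr eq (composite env x)) e)
  SubA-comp env con-ar s-con s-con = s-con
  SubA-comp env (app-ar p q) (s-app d₁ d₂) (s-app e₁ e₂) = s-app (SubA-comp env p d₁ e₁) (SubC-comp env q d₂ e₂)
  SubA-comp env (app-ar p q) (s-app d₁ d₂) (s-app-red e₁ e₂ e₃) =
    s-app-red (SubA-comp env p d₁ e₁) (SubC-comp env q d₂ e₂) e₃
  SubA-comp env (app-ar p q) (s-app-red d₁ d₂ d₃) e with ⊢a-sub (ar-σ env) p d₁
  ... | refl , lam-ar pB with SubC-exists (nτ env) (bounded-τ env) (ar-τ env) (lam-ar pB)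
  ... | _ , s-lam dB' with SubC-exists (nτ env) (bounded-τ env) (ar-τ env) (⊢c-sub (ar-σ env) q d₂)
  ... | N₂ , e₂ =
    s-app-red (SubA-comp env p d₁ (s-lam dB')) (SubC-comp env q d₂ e₂)
      (redex-comp (SubA-can-bounded (bounded-σ env) d₁) (nσ+nτ≤m env) (bounded-τ env) (ar-τ env)
                  pB dB' (⊢c-sub (ar-σ env) q d₂) e₂ d₃ e)

  -- [τ]([N₁/x]B) = [[τ]N₁/x]([⇑τ]B), both sides being computed as [extend ([τ]N₁) τ]B.
  redex-comp : ∀ {m nσ nτ τ Δ₂ Δ₃ α' α'' B B' N₁ N₂ E₁ E₂} →
               suc (size α' + size α'') ≤ nσ → nσ + nτ ≤ m → Bounded nτ τ → ArSub τ Δ₂ Δ₃ →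
               (α' ∷ Δ₂) ⊢c B ∶ α'' → SubC (⇑ τ) B B' → Δ₂ ⊢c N₁ ∶ α' → SubC τ N₁ N₂ →
               SubC (single N₁ α') B E₁ → SubC τ E₁ E₂ → SubC (single N₂ α') B' E₂
  redex-comp {suc m} {suc k} {nτ} {τ} {α' = α'} {α'' = α''} {B} {N₂ = N₂} {E₂ = E₂} (s≤s l₁) (s≤s l₂) b t pB dB' pN₁ e₂ d₃ e
    with SubC-exists (size α') Bounded-single (ArSub-single (⊢c-sub t pN₁ e₂)) (⊢c-sub (ArSub-⇑ t) pB dB')
  ... | E₃ , g = subst (SubC _ _) (SubC-det via-⇑τ via-single) g
    where
      α'≤k : size α' ≤ k
      α'≤k = ≤-trans (m≤m+n (size α') (size α'')) l₁
      bound : size α' + nτ ≤ m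
      bound = ≤-trans (+-monoˡ-≤ nτ α'≤k) l₂
      via-single : SubC (extend N₂ α' τ) B E₂
      via-single = SubC-comp (CompEnv-single b t pN₁ e₂ bound) pB d₃ e
      via-⇑τ : SubC (extend N₂ α' τ) B E₃
      via-⇑τ = SubC-comp (CompEnv-⇑-single b t (⊢c-sub t pN₁ e₂) (λ _ → refl)
                            (≤-trans (≤-reflexive (+-comm nτ (size α'))) bound)) pB dB' g

SubP-comp : ∀ {m σ τ ρ Δ₁ Δ₂ Δ₃ P P₁ P₂} → CompEnv σ τ ρ Δ₁ Δ₂ Δ₃ m → Δ₁ ⊢p P →
            SubP σ P P₁ → SubP τ P₁ P₂ → SubP ρ P P₂
SubP-comp env fam-ar        s-fam          s-fam          = s-fam
SubP-comp env (appT-ar p q) (s-appT d₁ d₂) (s-appT e₁ e₂) = s-appT (SubP-comp env p d₁ e₁) (SubC-comp env q d₂ e₂)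

SubTy-comp : ∀ {m σ τ ρ Δ₁ Δ₂ Δ₃ A A₁ A₂} → CompEnv σ τ ρ Δ₁ Δ₂ Δ₃ m → Δ₁ ⊢t A →
             SubTy σ A A₁ → SubTy τ A₁ A₂ → SubTy ρ A A₂
SubTy-comp env (atom-ar p) (s-atom d)  (s-atom e)  = s-atom (SubP-comp env p d e)
SubTy-comp env (Π-ar p q)  (s-Π d₁ d₂) (s-Π e₁ e₂) = s-Π (SubTy-comp env p d₁ e₁) (SubTy-comp (CompEnv-⇑ env) q d₂ e₂)

SubK-comp : ∀ {m σ τ ρ Δ₁ Δ₂ Δ₃ K K₁ K₂} → CompEnv σ τ ρ Δ₁ Δ₂ Δ₃ m → Δ₁ ⊢k K →
            SubK σ K K₁ → SubK τ K₁ K₂ → SubK ρ K K₂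
SubK-comp env Type-ar     s-Type       s-Type       = s-Type
SubK-comp env (ΠK-ar p q) (s-ΠK d₁ d₂) (s-ΠK e₁ e₂) = s-ΠK (SubTy-comp env p d₁ e₁) (SubK-comp (CompEnv-⇑ env) q d₂ e₂)

SubTy-single-commute : ∀ {σ Δ₁ Δ₂ n N N' α E E₁ E' E₂} → Bounded n σ → ArSub σ Δ₁ Δ₂ →
  (α ∷ Δ₁) ⊢t E → Δ₁ ⊢c N ∶ α → SubTy (single N α) E E₁ → SubC σ N N' →
  SubTy (⇑ σ) E E' → SubTy (single N' α) E' E₂ → SubTy σ E₁ E₂
SubTy-single-commute {σ} {n = n} {N' = N'} {α} {E} {E₂ = E₂} b t pE pN d₁ dN dE' dE₂
  with SubTy-exists n b t (⊢t-sub (ArSub-single pN) pE d₁)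
... | E₃ , d = subst (SubTy _ _) (SubTy-det via-single via-⇑σ) d
  where
    via-single : SubTy (extend N' α σ) E E₃
    via-single = SubTy-comp (CompEnv-single b t pN dN ≤-refl) pE d₁ d
    via-⇑σ : SubTy (extend N' α σ) E E₂
    via-⇑σ = SubTy-comp (CompEnv-⇑-single b t (⊢c-sub t pN dN) (λ _ → refl) (≤-reflexive (+-comm n (size α))))
                        pE dE' dE₂

SubK-single-commute : ∀ {σ Δ₁ Δ₂ n N N' α E E₁ E' E₂} → Bounded n σ → ArSub σ Δ₁ Δ₂ →
  (α ∷ Δ₁) ⊢k E → Δ₁ ⊢c N ∶ α → SubK (single N α) E E₁ → SubC σ N N' →
  SubK (⇑ σ) E E' → SubK (single N' α) E' E₂ → SubK σ E₁ E₂
SubK-single-commute {σ} {n = n} {N' = N'} {α} {E} {E₂ = E₂} b t pE pN d₁ dN dE' dE₂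
  with SubK-exists n b t (⊢k-sub (ArSub-single pN) pE d₁)
... | E₃ , d = subst (SubK _ _) (SubK-det via-single via-⇑σ) d
  where
    via-single : SubK (extend N' α σ) E E₃
    via-single = SubK-comp (CompEnv-single b t pN dN ≤-refl) pE d₁ d
    via-⇑σ : SubK (extend N' α σ) E E₂
    via-⇑σ = SubK-comp (CompEnv-⇑-single b t (⊢c-sub t pN dN) (λ _ → refl) (≤-reflexive (+-comm n (size α))))
                       pE dE' dE₂

eraseCtx : Ctx → List Ar
eraseCtx ∅       = []
eraseCtx (Γ , A) = erase A ∷ eraseCtx Γ

∋-erase : ∀ {Γ x A} → Γ ∋ x ∶ A → eraseCtx Γ ∋a x ∶ erase A
∋-erase (vz {Γ} {A}) = subst (λ α → (erase A ∷ eraseCtx Γ) ∋a zero ∶ α) (sym (erase-renTy suc A)) here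
∋-erase (vs {B = B} p) = subst (_ ∋a _ ∶_) (sym (erase-renTy suc B)) (there (∋-erase p))

∋a-lift : ∀ {Γ x α} → eraseCtx Γ ∋a x ∶ α → ∃ λ A → Γ ∋ x ∶ A × erase A ≡ α
∋a-lift {Γ , B} here = renTy suc B , vz , erase-renTy suc B
∋a-lift {Γ , B} (there p) with ∋a-lift p
... | A , q , e = renTy suc A , vs q , trans (erase-renTy suc A) e

module Erase (S : Sig) where
  open LF S

  mutual
    ⇐-erase : ∀ {Γ M A} → Γ ⊢ M ⇐ A → eraseCtx Γ ⊢c M ∶ erase A
    ⇐-erase (m-at p)  = at-ar (⇒-erase p)
    ⇐-erase (m-lam p) = lam-ar (⇐-erase p)

    ⇒-erase : ∀ {Γ R A} → Γ ⊢ R ⇒ A → eraseCtx Γ ⊢a R ∶ erase A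
    ⇒-erase (r-var p)     = var-ar (∋-erase p)
    ⇒-erase (r-con d)     = con-ar
    ⇒-erase (r-app p q d) = subst (_ ⊢a _ ∶_) (sym (erase-SubTy d)) (app-ar (⇒-erase p) (⇐-erase q))

  ⇒K-erase : ∀ {Γ P K} → Γ ⊢ P ⇒K K → eraseCtx Γ ⊢p P
  ⇒K-erase (p-fam d)     = fam-ar
  ⇒K-erase (p-app p q d) = appT-ar (⇒K-erase p) (⇐-erase q)

  type-erase : ∀ {Γ A} → Γ ⊢ A type → eraseCtx Γ ⊢t A
  type-erase (t-atom p) = atom-ar (⇒K-erase p)
  type-erase (t-Π p q)  = Π-ar (type-erase p) (type-erase q)

  kind-erase : ∀ {Γ K} → Γ ⊢ K kind → eraseCtx Γ ⊢k K
  kind-erase k-Type    = Type-ar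
  kind-erase (k-Π p q) = ΠK-ar (type-erase p) (kind-erase q)

module SigWeaken (S₁ S₂ : Sig) (⊆ : ∀ {d} → d ∈Σ S₁ → d ∈Σ S₂) where
  module L₁ = LF S₁
  module L₂ = LF S₂

  mutual
    ⇐-weaken : ∀ {Γ M A} → L₁._⊢_⇐_ Γ M A → L₂._⊢_⇐_ Γ M A
    ⇐-weaken (L₁.m-at p)  = L₂.m-at (⇒-weaken p)
    ⇐-weaken (L₁.m-lam p) = L₂.m-lam (⇐-weaken p)

    ⇒-weaken : ∀ {Γ R A} → L₁._⊢_⇒_ Γ R A → L₂._⊢_⇒_ Γ R A
    ⇒-weaken (L₁.r-var p)     = L₂.r-var p
    ⇒-weaken (L₁.r-con d)     = L₂.r-con (⊆ d)
    ⇒-weaken (L₁.r-app p q d) = L₂.r-app (⇒-weaken p) (⇐-weaken q) d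

  ⇒K-weaken : ∀ {Γ P K} → L₁._⊢_⇒K_ Γ P K → L₂._⊢_⇒K_ Γ P K
  ⇒K-weaken (L₁.p-fam d)     = L₂.p-fam (⊆ d)
  ⇒K-weaken (L₁.p-app p q d) = L₂.p-app (⇒K-weaken p) (⇐-weaken q) d

  type-weaken : ∀ {Γ A} → L₁._⊢_type Γ A → L₂._⊢_type Γ A
  type-weaken (L₁.t-atom p) = L₂.t-atom (⇒K-weaken p)
  type-weaken (L₁.t-Π p q)  = L₂.t-Π (type-weaken p) (type-weaken q)

  kind-weaken : ∀ {Γ K} → L₁._⊢_kind Γ K → L₂._⊢_kind Γ K
  kind-weaken L₁.k-Type    = L₂.k-Type
  kind-weaken (L₁.k-Π p q) = L₂.k-Π (type-weaken p) (kind-weaken q)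

∈Σ-wf : ∀ {S d} → WfSig S → d ∈Σ S → ∃ λ S₀ → (∀ {d'} → d' ∈Σ S₀ → d' ∈Σ S) × WfDecl S₀ d
∈Σ-wf (w-cons {S = S₀} w _ wd) here = S₀ , there , wd
∈Σ-wf (w-cons w _ _) (there p) with ∈Σ-wf w p
... | S₀ , ⊆ , wd = S₀ , there ∘ ⊆ , wd

cdec-ar : ∀ {S c A} → WfSig S → cdec c A ∈Σ S → [] ⊢t A
cdec-ar w p with ∈Σ-wf w p
... | S₀ , _ , wd = Erase.type-erase S₀ wd

adec-ar : ∀ {S a K} → WfSig S → adec a K ∈Σ S → [] ⊢k K
adec-ar w p with ∈Σ-wf w p
... | S₀ , _ , wd = Erase.kind-erase S₀ wd

adec-kind : ∀ {S a K} → WfSig S → adec a K ∈Σ S → LF._⊢_kind S ∅ K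
adec-kind {S} w p with ∈Σ-wf w p
... | S₀ , ⊆ , wd = SigWeaken.kind-weaken S₀ S ⊆ wd

-- Weakening and substitution for LF

module Metatheory (S : Sig)
  (cdec-ar : ∀ {c A} → cdec c A ∈Σ S → [] ⊢t A)
  (adec-ar : ∀ {a K} → adec a K ∈Σ S → [] ⊢k K) where
  open LF S
  open Erase S

  CtxRen : (ℕ → ℕ) → Ctx → Ctx → Set
  CtxRen ρ Γ₁ Γ₂ = ∀ {x A} → Γ₁ ∋ x ∶ A → Γ₂ ∋ ρ x ∶ renTy ρ A

  CtxRen-ext : ∀ {ρ Γ₁ Γ₂ A} → CtxRen ρ Γ₁ Γ₂ → CtxRen (ext ρ) (Γ₁ , A) (Γ₂ , renTy ρ A)
  CtxRen-ext {ρ} {Γ₂ = Γ₂} {A = A} r vz = subst ((Γ₂ , renTy ρ A) ∋ zero ∶_) (renTy-suc-ext ρ A) vz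
  CtxRen-ext {ρ} r (vs {B = B} p) = subst (_ ∋ _ ∶_) (renTy-suc-ext ρ B) (vs (r p))

  mutual
    ⇐-ren : ∀ {ρ Γ₁ Γ₂ M A} → CtxRen ρ Γ₁ Γ₂ → Γ₁ ⊢ M ⇐ A → Γ₂ ⊢ renTm ρ M ⇐ renTy ρ A
    ⇐-ren r (m-at p)  = m-at (⇒-ren r p)
    ⇐-ren r (m-lam p) = m-lam (⇐-ren (CtxRen-ext r) p)

    ⇒-ren : ∀ {ρ Γ₁ Γ₂ R A} → CtxRen ρ Γ₁ Γ₂ → Γ₁ ⊢ R ⇒ A → Γ₂ ⊢ renATm ρ R ⇒ renTy ρ A
    ⇒-ren r (r-var p) = r-var (r p)
    ⇒-ren r (r-con d) = subst (_ ⊢ _ ⇒_) (sym (renTy-fixes (λ ()) (cdec-ar d))) (r-con d)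
    ⇒-ren {ρ} r (r-app {M = M} {A₁ = A₁} p q d) =
      r-app (⇒-ren r p) (⇐-ren r q)
        (subst (λ α → SubTy (single (renTm ρ M) α) _ _) (sym (erase-renTy ρ A₁)) (SubTy-ren (single-ren ρ M (erase A₁)) d))

  ⇒K-ren : ∀ {ρ Γ₁ Γ₂ P K} → CtxRen ρ Γ₁ Γ₂ → Γ₁ ⊢ P ⇒K K → Γ₂ ⊢ renATy ρ P ⇒K renKind ρ K
  ⇒K-ren r (p-fam d) = subst (_ ⊢ _ ⇒K_) (sym (renKind-fixes (λ ()) (adec-ar d))) (p-fam d)
  ⇒K-ren {ρ} r (p-app {M = M} {A = A} p q d) =
    p-app (⇒K-ren r p) (⇐-ren r q)
      (subst (λ α → SubK (single (renTm ρ M) α) _ _) (sym (erase-renTy ρ A)) (SubK-ren (single-ren ρ M (erase A)) d))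

  type-ren : ∀ {ρ Γ₁ Γ₂ A} → CtxRen ρ Γ₁ Γ₂ → Γ₁ ⊢ A type → Γ₂ ⊢ renTy ρ A type
  type-ren r (t-atom p) = t-atom (⇒K-ren r p)
  type-ren r (t-Π p q)  = t-Π (type-ren r p) (type-ren (CtxRen-ext r) q)

  kind-ren : ∀ {ρ Γ₁ Γ₂ K} → CtxRen ρ Γ₁ Γ₂ → Γ₁ ⊢ K kind → Γ₂ ⊢ renKind ρ K kind
  kind-ren r k-Type    = k-Type
  kind-ren r (k-Π p q) = k-Π (type-ren r p) (kind-ren (CtxRen-ext r) q)

  kind-closed-weaken : ∀ {Γ K} → ∅ ⊢ K kind → Γ ⊢ K kind
  kind-closed-weaken p = subst (_ ⊢_kind) (renKind-fixes {ρ = id} (λ ()) (kind-erase p)) (kind-ren (λ ()) p)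

  ItemTyped : Ctx → SubItem → Ty → Ty → Set
  ItemTyped Γ (tm M α) A A' = α ≡ erase A × Γ ⊢ M ⇐ A'
  ItemTyped Γ (vr k)   A A' = Γ ∋ k ∶ A'

  CtxSub : Sub → Ctx → Ctx → Set
  CtxSub σ Γ₁ Γ₂ = ∀ {x A} → Γ₁ ∋ x ∶ A → ∃ λ A' → SubTy σ A A' × ItemTyped Γ₂ (σ x) A A'

  ItemTyped-weaken : ∀ {Γ B C C'} s → ItemTyped Γ s C C' → ItemTyped (Γ , B) (renItem suc s) (renTy suc C) (renTy suc C')
  ItemTyped-weaken {C = C} (tm M α) (e , p) = trans e (sym (erase-renTy suc C)) , ⇐-ren vs p
  ItemTyped-weaken (vr k) p = vs p

  CtxSub-⇑ : ∀ {σ Γ₁ Γ₂ B B'} → CtxSub σ Γ₁ Γ₂ → SubTy σ B B' → CtxSub (⇑ σ) (Γ₁ , B) (Γ₂ , B')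
  CtxSub-⇑ {B' = B'} l d vz = renTy suc B' , SubTy-⇑-weaken d , vz
  CtxSub-⇑ {σ} {Γ₂ = Γ₂} {B' = B'} l d (vs {B = C} {x = x} p) with l p
  ... | C' , e , i = renTy suc C' , SubTy-⇑-weaken e ,
        subst (λ s → ItemTyped (Γ₂ , B') s (renTy suc C) (renTy suc C')) (sym (⇑-suc σ x)) (ItemTyped-weaken (σ x) i)

  CtxSub-single : ∀ {Γ N A α} → Γ ⊢ N ⇐ A → α ≡ erase A → CtxSub (single N α) (Γ , A) Γ
  CtxSub-single {N = N} {A = A} {α = α} q e vz = A , SubTy-single-weaken N α A , trans e (sym (erase-renTy suc A)) , q
  CtxSub-single {N = N} {α = α} q e (vs {B = C} p) = C , SubTy-single-weaken N α C , p

  CtxSub-ar : ∀ {σ Γ₁ Γ₂} → CtxSub σ Γ₁ Γ₂ → ArSub σ (eraseCtx Γ₁) (eraseCtx Γ₂)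
  CtxSub-ar {σ} l {x} p with ∋a-lift p
  ... | A , q , refl with l q
  ... | A' , d , i = item-ar (σ x) i (erase-SubTy d)
    where
      item-ar : ∀ {Γ A A'} s → ItemTyped Γ s A A' → erase A' ≡ erase A → ItemOk (eraseCtx Γ) s (erase A)
      item-ar (tm M β) (e , p) e' = e , subst (_ ⊢c M ∶_) e' (⇐-erase p)
      item-ar (vr k)   p       e' = subst (_ ∋a k ∶_) e' (∋-erase p)

  ArCtx : Ctx → Set
  ArCtx Γ = ∀ {x A} → Γ ∋ x ∶ A → eraseCtx Γ ⊢t A

  ArCtx-ext : ∀ {Γ B} → ArCtx Γ → eraseCtx Γ ⊢t B → ArCtx (Γ , B)
  ArCtx-ext ok okB vz     = ⊢t-ren there okB
  ArCtx-ext ok okB (vs p) = ⊢t-ren there (ok p)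

  ArCtx-wf : ∀ {Γ} → ⊢ Γ ctx → ArCtx Γ
  ArCtx-wf c-nil ()
  ArCtx-wf (c-cons w t) = ArCtx-ext (ArCtx-wf w) (type-erase t)

  ⇒-ar : ∀ {Γ R A} → ArCtx Γ → Γ ⊢ R ⇒ A → eraseCtx Γ ⊢t A
  ⇒-ar ok (r-var p) = ok p
  ⇒-ar ok (r-con d) = ⊢t-closed (cdec-ar d)
  ⇒-ar ok (r-app p q d) with ⇒-ar ok p
  ... | Π-ar okA₁ okA₂ = ⊢t-sub (ArSub-single (⇐-erase q)) okA₂ d

  ⇒K-ar : ∀ {Γ P K} → ArCtx Γ → Γ ⊢ P ⇒K K → eraseCtx Γ ⊢k K
  ⇒K-ar ok (p-fam d) = ⊢k-closed (adec-ar d)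
  ⇒K-ar ok (p-app p q d) with ⇒K-ar ok p
  ... | ΠK-ar okA okK = ⊢k-sub (ArSub-single (⇐-erase q)) okK d

  record SubEnv (σ : Sub) (Γ₁ Γ₂ : Ctx) : Set where
    field
      bound    : ℕ
      bounded  : Bounded bound σ
      ctx-sub  : CtxSub σ Γ₁ Γ₂
      ar-ctx₁  : ArCtx Γ₁
      ar-ctx₂  : ArCtx Γ₂

    ar-sub : ArSub σ (eraseCtx Γ₁) (eraseCtx Γ₂)
    ar-sub = CtxSub-ar ctx-sub
  open SubEnv

  SubEnv-⇑ : ∀ {σ Γ₁ Γ₂ B B'} → SubEnv σ Γ₁ Γ₂ → SubTy σ B B' → eraseCtx Γ₁ ⊢t B → SubEnv (⇑ σ) (Γ₁ , B) (Γ₂ , B')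
  SubEnv-⇑ env d okB = record
    { bound = bound env ; bounded = Bounded-⇑ (bounded env) ; ctx-sub = CtxSub-⇑ (ctx-sub env) d
    ; ar-ctx₁ = ArCtx-ext (ar-ctx₁ env) okB ; ar-ctx₂ = ArCtx-ext (ar-ctx₂ env) (⊢t-sub (ar-sub env) okB d) }

  SubEnv-single : ∀ {Γ N A α} → ArCtx Γ → eraseCtx Γ ⊢t A → Γ ⊢ N ⇐ A → α ≡ erase A →
                  SubEnv (single N α) (Γ , A) Γ
  SubEnv-single {α = α} ok okA pN e = record
    { bound = size α ; bounded = Bounded-single ; ctx-sub = CtxSub-single pN e
    ; ar-ctx₁ = ArCtx-ext ok okA ; ar-ctx₂ = ok }

  ResTyped : Ctx → ARes → Ty → Ty → Set
  ResTyped Γ (atm R)   A A' = Γ ⊢ R ⇒ A'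
  ResTyped Γ (can M α) A A' = α ≡ erase A × Γ ⊢ M ⇐ A'

  ItemTyped-tm : ∀ {Γ s M α A A'} → s ≡ tm M α → ItemTyped Γ s A A' → α ≡ erase A × Γ ⊢ M ⇐ A'
  ItemTyped-tm refl i = i

  ItemTyped-vr : ∀ {Γ s k A A'} → s ≡ vr k → ItemTyped Γ s A A' → Γ ∋ k ∶ A'
  ItemTyped-vr refl i = i

  Π-instance-sub : ∀ {σ Γ₁ Γ₂ A₁ A₂ A₂' A N N'} → SubEnv σ Γ₁ Γ₂ → (erase A₁ ∷ eraseCtx Γ₁) ⊢t A₂ →
                   Γ₁ ⊢ N ⇐ A₁ → SubTy (single N (erase A₁)) A₂ A → SubC σ N N' → SubTy (⇑ σ) A₂ A₂' →
                   eraseCtx Γ₂ ⊢c N' ∶ erase A₁ → ∃ λ A' → SubTy σ A A' × SubTy (single N' (erase A₁)) A₂' A'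
  Π-instance-sub {A₁ = A₁} env okA₂ pN dA dN e₂ pN'
    with SubTy-exists (size (erase A₁)) Bounded-single (ArSub-single pN') (⊢t-sub (ArSub-⇑ (ar-sub env)) okA₂ e₂)
  ... | A' , d = A' , SubTy-single-commute (bounded env) (ar-sub env) okA₂ (⇐-erase pN) dA dN e₂ d , d

  mutual
    ⇐-sub : ∀ {σ Γ₁ Γ₂ M M' A A'} → SubEnv σ Γ₁ Γ₂ → eraseCtx Γ₁ ⊢t A → Γ₁ ⊢ M ⇐ A →
            SubC σ M M' → SubTy σ A A' → Γ₂ ⊢ M' ⇐ A'
    ⇐-sub env okA (m-at pR) (s-at d) (s-atom dP) with ⇒-sub env pR d
    ... | A'' , dA'' , r = m-at (subst (_ ⊢ _ ⇒_) (SubTy-det dA'' (s-atom dP)) r)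
    ⇐-sub env okA (m-at pR) (s-at-can d) dA with ⇒-sub env pR d
    ... | A'' , dA'' , _ , c = subst (_ ⊢ _ ⇐_) (SubTy-det dA'' dA) c
    ⇐-sub env (Π-ar okA₁ okA₂) (m-lam pM) (s-lam d) (s-Π d₁ d₂) =
      m-lam (⇐-sub (SubEnv-⇑ env d₁ okA₁) okA₂ pM d d₂)

    ⇒-sub : ∀ {σ Γ₁ Γ₂ R r A} → SubEnv σ Γ₁ Γ₂ → Γ₁ ⊢ R ⇒ A → SubA σ R r →
            ∃ λ A' → SubTy σ A A' × ResTyped Γ₂ r A A'
    ⇒-sub env (r-var p) (s-var-in eq) with ctx-sub env p
    ... | A' , d , i = A' , d , ItemTyped-tm eq i
    ⇒-sub env (r-var p) (s-var-out eq) with ctx-sub env p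
    ... | A' , d , i = A' , d , r-var (ItemTyped-vr eq i)
    ⇒-sub env (r-con dec) s-con = _ , SubTy-closed (cdec-ar dec) , r-con dec
    ⇒-sub env (r-app pR pN dA) (s-app d₁ d₂) with ⇒-sub env pR d₁ | ⇒-ar (ar-ctx₁ env) pR
    ... | ΠT A₁' A₂' , s-Π e₁ e₂ , rR | Π-ar okA₁ okA₂
      with ⇐-sub env okA₁ pN d₂ e₁
    ... | pN'
      with Π-instance-sub env okA₂ pN dA d₂ e₂ (subst (_ ⊢c _ ∶_) (erase-SubTy e₁) (⇐-erase pN'))
    ... | A' , d , dI = A' , d , r-app rR pN' (subst (λ α → SubTy (single _ α) _ _) (sym (erase-SubTy e₁)) dI)
    ⇒-sub env (r-app pR pN dA) (s-app-red d₁ d₂ d₃) with ⇒-sub env pR d₁ | ⇒-ar (ar-ctx₁ env) pR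
    ... | ΠT A₁' A₂' , s-Π e₁ e₂ , (refl , m-lam pB) | Π-ar okA₁ okA₂
      with ⇐-sub env okA₁ pN d₂ e₁
    ... | pN'
      with Π-instance-sub env okA₂ pN dA d₂ e₂ (subst (_ ⊢c _ ∶_) (erase-SubTy e₁) (⇐-erase pN'))
    ... | A' , d , dI = A' , d , sym (erase-SubTy dA) , ⇐-sub env' okA₂' pB d₃ dI
      where
        okA₂' : (erase A₁' ∷ eraseCtx _) ⊢t A₂'
        okA₂' = subst (λ α → (α ∷ _) ⊢t A₂') (sym (erase-SubTy e₁)) (⊢t-sub (ArSub-⇑ (ar-sub env)) okA₂ e₂)
        env' : SubEnv (single _ _) (_ , A₁') _
        env' = SubEnv-single (ar-ctx₂ env) (⊢t-sub (ar-sub env) okA₁ e₁) pN' (sym (erase-SubTy e₁))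

  ⇒K-sub : ∀ {σ Γ₁ Γ₂ P P' K} → SubEnv σ Γ₁ Γ₂ → Γ₁ ⊢ P ⇒K K → SubP σ P P' →
           ∃ λ K' → SubK σ K K' × Γ₂ ⊢ P' ⇒K K'
  ⇒K-sub env (p-fam dec) s-fam = _ , SubK-closed (adec-ar dec) , p-fam dec
  ⇒K-sub env (p-app {A = A} pP pM dK) (s-appT d₁ d₂) with ⇒K-sub env pP d₁ | ⇒K-ar (ar-ctx₁ env) pP
  ... | ΠK A' K₁' , s-ΠK e₁ e₂ , rP | ΠK-ar okA okK₁
    with ⇐-sub env okA pM d₂ e₁
  ... | pM' with SubK-exists (size (erase A)) Bounded-single
                   (ArSub-single (subst (_ ⊢c _ ∶_) (erase-SubTy e₁) (⇐-erase pM')))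
                   (⊢k-sub (ArSub-⇑ (ar-sub env)) okK₁ e₂)
  ... | K' , dI = K' , SubK-single-commute (bounded env) (ar-sub env) okK₁ (⇐-erase pM) dK d₂ e₂ dI ,
                  p-app rP pM' (subst (λ α → SubK (single _ α) _ _) (sym (erase-SubTy e₁)) dI)

  type-sub : ∀ {σ Γ₁ Γ₂ A A'} → SubEnv σ Γ₁ Γ₂ → Γ₁ ⊢ A type → SubTy σ A A' → Γ₂ ⊢ A' type
  type-sub env (t-atom pP) (s-atom d) with ⇒K-sub env pP d
  ... | _ , s-Type , r = t-atom r
  type-sub env (t-Π pA pB) (s-Π d₁ d₂) = t-Π (type-sub env pA d₁) (type-sub (SubEnv-⇑ env d₁ (type-erase pA)) pB d₂)

  kind-sub : ∀ {σ Γ₁ Γ₂ K K'} → SubEnv σ Γ₁ Γ₂ → Γ₁ ⊢ K kind → SubK σ K K' → Γ₂ ⊢ K' kind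
  kind-sub env k-Type    s-Type       = k-Type
  kind-sub env (k-Π pA pK) (s-ΠK d₁ d₂) = k-Π (type-sub env pA d₁) (kind-sub (SubEnv-⇑ env d₁ (type-erase pA)) pK d₂)

  kind-single-sub : ∀ {Γ A M K K'} → ArCtx Γ → Γ ⊢ A type → (Γ , A) ⊢ K kind → Γ ⊢ M ⇐ A →
                    SubK (single M (erase A)) K K' → Γ ⊢ K' kind
  kind-single-sub ok tA pK pM = kind-sub (SubEnv-single ok (type-erase tA) pM refl) pK

-- Telescopes

bindings : ∀ {n} → Vec Tm n → Vec Ty n → List (Tm × Ar)
bindings Ms As = toList (zip Ms (map erase As))

take-bindings-∷ʳ : ∀ {n} (Ms : Vec Tm n) (As : Vec Ty n) M B k → k ≤ n →
                   take k (bindings (Ms ∷ʳ M) (As ∷ʳ B)) ≡ take k (bindings Ms As)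
take-bindings-∷ʳ Ms       As       M B zero    le       = refl
take-bindings-∷ʳ (N ∷ Ms) (A ∷ As) M B (suc k) (s≤s le) = cong ((N , erase A) ∷_) (take-bindings-∷ʳ Ms As M B k le)

take-bindings-all : ∀ {n} (Ms : Vec Tm n) (As : Vec Ty n) → take n (bindings Ms As) ≡ bindings Ms As
take-bindings-all []       []       = refl
take-bindings-all (N ∷ Ms) (A ∷ As) = cong ((N , erase A) ∷_) (take-bindings-all Ms As)

take-bindings-∷ʳ-all : ∀ {n} (Ms : Vec Tm n) (As : Vec Ty n) M B →
                       take (suc n) (bindings (Ms ∷ʳ M) (As ∷ʳ B)) ≡ bindings Ms As ++ (M , erase B) ∷ []
take-bindings-∷ʳ-all []       []       M B = refl
take-bindings-∷ʳ-all (N ∷ Ms) (A ∷ As) M B = cong ((N , erase A) ∷_) (take-bindings-∷ʳ-all Ms As M B)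

prefixSub-∷ʳ : ∀ {n} (Ms : Vec Tm n) (As : Vec Ty n) M B k → k ≤ n →
               prefixSub (Ms ∷ʳ M) (As ∷ʳ B) k ≡ prefixSub Ms As k
prefixSub-∷ʳ Ms As M B k le = cong (multi ∘ reverse) (take-bindings-∷ʳ Ms As M B k le)

prefixSub-∷ʳ-all : ∀ {n} (Ms : Vec Tm n) (As : Vec Ty n) M B →
                   extend M (erase B) (prefixSub Ms As n) ≗ prefixSub (Ms ∷ʳ M) (As ∷ʳ B) (suc n)
prefixSub-∷ʳ-all Ms As M B x
  rewrite take-bindings-∷ʳ-all Ms As M B | reverse-++ (bindings Ms As) ((M , erase B) ∷ []) | take-bindings-all Ms As
  with x
... | zero  = refl
... | suc y = refl

piK-∷ʳ : ∀ {n} (As : Vec Ty n) B K → piK (toList (As ∷ʳ B)) K ≡ piK (toList As) (ΠK B K)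
piK-∷ʳ []       B K = refl
piK-∷ʳ (A ∷ As) B K = cong (ΠK A) (piK-∷ʳ As B K)

appsT-∷ʳ : ∀ {n} (Ms : Vec Tm n) M P → appsT P (toList (Ms ∷ʳ M)) ≡ appT (appsT P (toList Ms)) M
appsT-∷ʳ []       M P = refl
appsT-∷ʳ (N ∷ Ms) M P = appsT-∷ʳ Ms M (appT P N)

data LastView : ∀ n → Fin (suc n) → Set where
  last : ∀ {n} → LastView n (fromℕ n)
  init : ∀ {n} (j : Fin n) → LastView n (inject₁ j)

lastView : ∀ n (i : Fin (suc n)) → LastView n i
lastView zero    Fin.zero    = last
lastView (suc n) Fin.zero    = init Fin.zero
lastView (suc n) (Fin.suc i) with lastView n i
... | last   = last
... | init j = init (Fin.suc j)

lookup-∷ʳ-last : ∀ {A : Set} {n} (xs : Vec A n) x → lookup (xs ∷ʳ x) (fromℕ n) ≡ x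
lookup-∷ʳ-last []       x = refl
lookup-∷ʳ-last (y ∷ xs) x = lookup-∷ʳ-last xs x

lookup-∷ʳ-inject₁ : ∀ {A : Set} {n} (xs : Vec A n) x j → lookup (xs ∷ʳ x) (inject₁ j) ≡ lookup xs j
lookup-∷ʳ-inject₁ (y ∷ xs) x Fin.zero    = refl
lookup-∷ʳ-inject₁ (y ∷ xs) x (Fin.suc j) = lookup-∷ʳ-inject₁ xs x j

module Spines (S : Sig) (wf : WfSig S) (Γ : Ctx) (wfΓ : LF.⊢_ctx S Γ) where
  open LF S
  open Erase S
  open Metatheory S (cdec-ar wf) (adec-ar wf)

  Arguments : ∀ {n} → Vec Tm n → Vec Ty n → Vec Ty n → Set
  Arguments {n} Ms As As' = (i : Fin n) →
    SubTy (prefixSub Ms As (toℕ i)) (lookup As i) (lookup As' i) × Γ ⊢ lookup Ms i ⇐ lookup As' i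

  Spine : ATy → Kind → Set
  Spine P K' = ∃[ a ] ∃[ n ] ∃[ As ] ∃[ K ] ∃[ Ms ] ∃[ As' ]
    (adec a (piK (toList {n = n} As) K) ∈Σ S × P ≡ appsT (fam a) (toList {n = n} Ms) ×
     Arguments Ms As As' × SubK (prefixSub Ms As n) K K' × Γ ⊢ K' kind)

  Arguments-∷ʳ : ∀ {n} {Ms : Vec Tm n} {As As' M B A} → Arguments Ms As As' →
                 SubTy (prefixSub Ms As n) B A → Γ ⊢ M ⇐ A → Arguments (Ms ∷ʳ M) (As ∷ʳ B) (As' ∷ʳ A)
  Arguments-∷ʳ {n} {Ms} {As} {As'} {M} {B} {A} args e pM i with lastView n i
  ... | last rewrite toℕ-fromℕ n | lookup-∷ʳ-last Ms M | lookup-∷ʳ-last As B | lookup-∷ʳ-last As' A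
                   | prefixSub-∷ʳ Ms As M B n ≤-refl = e , pM
  ... | init j rewrite toℕ-inject₁ j | lookup-∷ʳ-inject₁ Ms M j | lookup-∷ʳ-inject₁ As B j | lookup-∷ʳ-inject₁ As' A j
                     | prefixSub-∷ʳ Ms As M B (toℕ j) (<⇒≤ (toℕ<n j)) = args j

  Arguments-init : ∀ {n} {Ms : Vec Tm n} {As As' M B A} → Arguments (Ms ∷ʳ M) (As ∷ʳ B) (As' ∷ʳ A) →
                   Arguments Ms As As' × SubTy (prefixSub Ms As n) B A × Γ ⊢ M ⇐ A
  Arguments-init {n} {Ms} {As} {As'} {M} {B} {A} args = earlier , final
    where
      earlier : Arguments Ms As As'
      earlier j with args (inject₁ j)
      ... | r rewrite toℕ-inject₁ j | lookup-∷ʳ-inject₁ Ms M j | lookup-∷ʳ-inject₁ As B j | lookup-∷ʳ-inject₁ As' A j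
                    | prefixSub-∷ʳ Ms As M B (toℕ j) (<⇒≤ (toℕ<n j)) = r
      final : SubTy (prefixSub Ms As n) B A × Γ ⊢ M ⇐ A
      final with args (fromℕ n)
      ... | r rewrite toℕ-fromℕ n | lookup-∷ʳ-last Ms M | lookup-∷ʳ-last As B | lookup-∷ʳ-last As' A
                    | prefixSub-∷ʳ Ms As M B n ≤-refl = r

  -- The invariant of the argument-by-argument induction.
  record ArTelescope {n} (Ms : Vec Tm n) (As : Vec Ty n) (K : Kind) : Set where
    constructor mkArTelescope
    field
      scope        : List Ar
      bound        : ℕ
      args-ar      : ArSub (prefixSub Ms As n) scope (eraseCtx Γ)
      rest-ar      : scope ⊢k K
      args-bounded : Bounded bound (prefixSub Ms As n)

  ArTelescope-∷ʳ : ∀ {n} {Ms : Vec Tm n} {As M B K} → ArTelescope Ms As (ΠK B K) → eraseCtx Γ ⊢c M ∶ erase B →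
                   ArTelescope (Ms ∷ʳ M) (As ∷ʳ B) K
  ArTelescope-∷ʳ {Ms = Ms} {As} {M} {B} (mkArTelescope Δ b t (ΠK-ar _ okK) bd) pM =
    mkArTelescope (erase B ∷ Δ) (size (erase B) + b) (ArSub-cong (prefixSub-∷ʳ-all Ms As M B) (ArSub-extend t pM))
                  okK (Bounded-cong (prefixSub-∷ʳ-all Ms As M B) (Bounded-extend bd))

  arTelescope : ∀ n {a K} (Ms : Vec Tm n) (As As' : Vec Ty n) → adec a (piK (toList As) K) ∈Σ S →
                Arguments Ms As As' → ArTelescope Ms As K
  arTelescope zero [] [] [] mem args = mkArTelescope [] 0 (λ ()) (adec-ar wf mem) (λ _ → tt)
  arTelescope (suc n) Ms As As' mem args with initLast Ms | initLast As | initLast As'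
  ... | Ms₀ , M , refl | As₀ , B , refl | As₀' , A , refl with Arguments-init {As' = As₀'} args
  ... | args₀ , e , pM =
    ArTelescope-∷ʳ (arTelescope n Ms₀ As₀ As₀' (subst (λ K → adec _ K ∈Σ S) (piK-∷ʳ As₀ B _) mem) args₀)
                   (subst (_ ⊢c M ∶_) (erase-SubTy e) (⇐-erase pM))

  SubK-prefixSub-∷ʳ : ∀ {n} {Ms : Vec Tm n} {As M B K K₁ K'} → ArTelescope Ms As (ΠK B K) →
                      eraseCtx Γ ⊢c M ∶ erase B → SubK (⇑ (prefixSub Ms As n)) K K₁ → SubK (single M (erase B)) K₁ K' →
                      SubK (prefixSub (Ms ∷ʳ M) (As ∷ʳ B) (suc n)) K K'
  SubK-prefixSub-∷ʳ {Ms = Ms} {As} {M} {B} (mkArTelescope Δ b t (ΠK-ar _ okK) bd) pM =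
    SubK-comp (CompEnv-⇑-single bd t pM (prefixSub-∷ʳ-all Ms As M B) ≤-refl) okK

  ⇒K-spine : ∀ {P K'} → Γ ⊢ P ⇒K K' → Spine P K'
  ⇒K-spine (p-fam {a = a} {K = K} mem) =
    a , 0 , [] , K , [] , [] , mem , refl , (λ ()) , SubK-closed (adec-ar wf mem) , kind-closed-weaken (adec-kind wf mem)
  ⇒K-spine (p-app {M = M} {A = A} pP pM dK) with ⇒K-spine pP
  ... | a , n , As , ΠK B K , Ms , As' , mem , refl , args , s-ΠK e₁ e₂ , k-Π tA pK₁ =
    a , suc n , As ∷ʳ B , K , Ms ∷ʳ M , As' ∷ʳ A ,
    subst (λ K → adec a K ∈Σ S) (sym (piK-∷ʳ As B K)) mem ,
    sym (appsT-∷ʳ Ms M (fam a)) ,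
    Arguments-∷ʳ {As' = As'} args e₁ pM ,
    SubK-prefixSub-∷ʳ (arTelescope n Ms As As' mem args) (subst (_ ⊢c M ∶_) (erase-SubTy e₁) (⇐-erase pM)) e₂
                      (subst (λ α → SubK (single M α) _ _) (erase-SubTy e₁) dK) ,
    kind-single-sub (ArCtx-wf wfΓ) tA pK₁ pM dK

  ⇒K-∷ʳ : ∀ {n} {Ms : Vec Tm n} {As P M B A K K'} → ArTelescope Ms As (ΠK B K) →
          (∀ {K₀} → SubK (prefixSub Ms As n) (ΠK B K) K₀ → Γ ⊢ P ⇒K K₀) →
          SubTy (prefixSub Ms As n) B A → Γ ⊢ M ⇐ A →
          SubK (prefixSub (Ms ∷ʳ M) (As ∷ʳ B) (suc n)) K K' → Γ ⊢ appT P M ⇒K K'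
  ⇒K-∷ʳ {M = M} {B} tel@(mkArTelescope Δ b t okΠ bd) ⇒K-P e pM dK
    with SubK-exists b bd t okΠ | okΠ
  ... | ΠK _ K₁ , s-ΠK f₁ f₂ | ΠK-ar _ okK with SubTy-det f₁ e
  ... | refl with subst (_ ⊢c M ∶_) (erase-SubTy e) (⇐-erase pM)
  ... | pM-ar with SubK-exists (size (erase B)) Bounded-single (ArSub-single pM-ar) (⊢k-sub (ArSub-⇑ t) okK f₂)
  ... | K'' , g =
    p-app (⇒K-P (s-ΠK f₁ f₂)) pM
      (subst₂ (λ α K → SubK (single M α) K₁ K) (sym (erase-SubTy e)) (SubK-det (SubK-prefixSub-∷ʳ tel pM-ar f₂ g) dK) g)

  spine-⇒K : ∀ n {a K} (Ms : Vec Tm n) (As As' : Vec Ty n) → adec a (piK (toList As) K) ∈Σ S →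
             Arguments Ms As As' → ∀ {K'} → SubK (prefixSub Ms As n) K K' → Γ ⊢ appsT (fam a) (toList Ms) ⇒K K'
  spine-⇒K zero [] [] [] mem args d = subst (Γ ⊢ fam _ ⇒K_) (SubK-det (SubK-closed (adec-ar wf mem)) d) (p-fam mem)
  spine-⇒K (suc n) {a} {K} Ms As As' mem args d with initLast Ms | initLast As | initLast As'
  ... | Ms₀ , M , refl | As₀ , B , refl | As₀' , A , refl with Arguments-init {As' = As₀'} args
  ... | args₀ , e , pM =
    subst (λ P → Γ ⊢ P ⇒K _) (sym (appsT-∷ʳ Ms₀ M (fam _)))
      (⇒K-∷ʳ (arTelescope n Ms₀ As₀ As₀' mem₀ args₀) (spine-⇒K n Ms₀ As₀ As₀' mem₀ args₀) e pM d)
    where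
      mem₀ : adec a (piK (toList As₀) (ΠK B K)) ∈Σ S
      mem₀ = subst (λ K → adec a K ∈Σ S) (piK-∷ʳ As₀ B K) mem

theorem2p21 : (S : Sig) → WfSig S → (Γ : Ctx) → LF.⊢_ctx S Γ →
    (P : ATy) → (K' : Kind) →
    LF._⊢_⇒K_ S Γ P K' ⇔
      (∃[ a ] ∃[ n ] ∃[ As ] ∃[ K ] ∃[ Ms ] ∃[ As' ]
        (adec a (piK (toList {n = n} As) K) ∈Σ S
        × P ≡ appsT (fam a) (toList {n = n} Ms)
        × ((i : Fin n) →
             SubTy (prefixSub Ms As (toℕ i)) (lookup As i) (lookup As' i)
             × LF._⊢_⇐_ S Γ (lookup Ms i) (lookup As' i))
        × SubK (prefixSub Ms As n) K K'
        × LF._⊢_kind S Γ K'))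
theorem2p21 S wf Γ wfΓ P K' = mk⇔ ⇒K-spine
  (λ { (a , n , As , K , Ms , As' , mem , refl , args , d , _) → spine-⇒K n Ms As As' mem args d })
  where open Spines S wf Γ wfΓ
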